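{- The category $\mathbf{EqHyp}$ of hypergraphs with equivalence is $\mathsf{Pb}$-adhesive.
   Context: For a set $X$, $X^\star$ denotes the set of finite words over $X$ (the free monoid on $X$), and for a function $f\colon X\to Y$, $f^\star\colon X^\star\to Y^\star$ applies $f$ letterwise. A hypergraph is a tuple $(E,V,s,t)$ with $E,V$ sets and $s,t\colon E\to V^\star$ functions. A hypergraph with equivalence is a tuple $\mathcal G=(E_{\mathcal G},V_{\mathcal G},Q_{\mathcal G},s_{\mathcal G},t_{\mathcal G},q_{\mathcal G})$ where $(E_{\mathcal G},V_{\mathcal G},s_{\mathcal G},t_{\mathcal G})$ is a hypergraph, $Q_{\mathcal G}$ is a set and $q_{\mathcal G}\colon V_{\mathcal G}\to Q_{\mathcal G}$ is a surjection. A morphism $\mathcal G\to\mathcal H$ is a triple $(h_E,h_V,h_Q)$ of functions $h_E\colon E_{\mathcal G}\to E_{\mathcal H}$, $h_V\colon V_{\mathcal G}\to V_{\mathcal H}$, $h_Q\colon Q_{\mathcal G}\to Q_{\mathcal H}$ with $h_V^\star\circ s_{\mathcal G}=s_{\mathcal H}\circ h_E$, $h_V^\star\circ t_{\mathcal G}=t_{\mathcal H}\circ h_E$ and $h_Q\circ q_{\mathcal G}=q_{\mathcal H}\circ h_V$. This gives the category $\mathbf{EqHyp}$. $\mathsf{Pb}$ is the class of morphisms $(h_E,h_V,h_Q)\colon\mathcal G\to\mathcal H$ of $\mathbf{EqHyp}$ that are regular monomorphisms in $\mathbf{EqHyp}$ and such that the commutative square $q_{\mathcal H}\circ h_V=h_Q\circ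 q_{\mathcal G}$ is a pullback in $\mathbf{Set}$. $\mathcal M$-adhesivity: let $\mathbf X$ be a category and $\mathcal M$ a class of monomorphisms of $\mathbf X$ containing all isomorphisms, closed under composition, closed under decomposition (if $g\in\mathcal M$ and $g\circ f\in\mathcal M$ then $f\in\mathcal M$), and stable under pullbacks and pushouts (in a pullback, resp. pushout, square the arrow parallel to an arrow of $\mathcal M$ is in $\mathcal M$). Consider a commutative cube with bottom face $f\colon A\to B$, $m\colon A\to C$, $n\colon B\to D$, $g\colon C\to D$, top face $f'\colon A'\to B'$, $m'\colon A'\to C'$, $n'\colon B'\to D'$, $g'\colon C'\to D'$, and vertical arrows $a\colon A'\to A$, $b\colon B'\to B$, $c\colon C'\to C$, $d\colon D'\to D$; its back face is the square on $A',B',A,B$, left face on $A',C',A,C$, front face on $C',D',C,D$, right face on $B',D',B,D$. For a class $\mathcal A$ of arrows, the bottom square is $\mathcal A$-Van Kampen if it is a pushout and, for every such commutative cube whose back and left faces are pullbacks and whose vertical arrows are in $\mathcal A$, the top face is a pushout if and only if the front and right faces are pullbacks. $\mathbf X$ is $\mathcal M$-adhesive if it has pullbacks along arrows of $\mathcal M$, pushouts along arrows of $\mathcal M$, and every pushout along an arrow of $\mathcal M$ is $\mathcal M$-Van Kampen. -}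

module Defs where

open import Level using (0ℓ)
open import Relation.Binary.Bundles using (Setoid)
open import Relation.Binary.PropositionalEquality as ≡ using (_≡_)
open import Data.List using (List; map)
import Data.List.Relation.Binary.Pointwise as PW
open import Data.List.Properties using (map-∘)
open import Data.Product using (Σ; ∃; ∃₂; _×_; _,_)
open import Function.Bundles using (Func)

open Setoid using (Carrier) renaming (_≈_ to [_]_≈_)
open Func using (to; cong)

-- Conventions: "sets" are rendered as setoids
-- (Setoid 0ℓ 0ℓ), functions as setoid maps (Func), equality of
-- functions as pointwise equality.

_⋆ : Setoid 0ℓ 0ℓ → Setoid 0ℓ 0ℓ
X ⋆ = PW.setoid X

_⋆ᶠ : {X Y : Setoid 0ℓ 0ℓ} → Func X Y → Func (X ⋆) (Y ⋆)
_⋆ᶠ {X} {Y} f = record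
  { to   = map (to f)
  ; cong = λ p → PW.map⁺ (to f) (to f) (PW.map (cong f) p) }

_∘ᶠ_ : {X Y Z : Setoid 0ℓ 0ℓ} → Func Y Z → Func X Y → Func X Z
g ∘ᶠ f = record { to = λ x → to g (to f x) ; cong = λ p → cong g (cong f p) }

idᶠ : {X : Setoid 0ℓ 0ℓ} → Func X X
idᶠ = record { to = λ x → x ; cong = λ p → p }

_≈ᶠ_ : {X Y : Setoid 0ℓ 0ℓ} → Func X Y → Func X Y → Set
_≈ᶠ_ {X} {Y} f g = ∀ x → [ Y ] to f x ≈ to g x

Surjective : {X Y : Setoid 0ℓ 0ℓ} → Func X Y → Set
Surjective {X} {Y} f = ∀ (y : Carrier Y) → ∃ λ (x : Carrier X) → [ Y ] to f x ≈ y

IsSetPullback : {P B C D : Setoid 0ℓ 0ℓ} →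
  (f : Func B D) (g : Func C D) (p₁ : Func P B) (p₂ : Func P C) → Set₁
IsSetPullback {P} {B} {C} {D} f g p₁ p₂ =
  ((f ∘ᶠ p₁) ≈ᶠ (g ∘ᶠ p₂)) ×
  (∀ (X : Setoid 0ℓ 0ℓ) (x₁ : Func X B) (x₂ : Func X C) →
     (f ∘ᶠ x₁) ≈ᶠ (g ∘ᶠ x₂) →
     Σ (Func X P) λ u → ((p₁ ∘ᶠ u) ≈ᶠ x₁) × ((p₂ ∘ᶠ u) ≈ᶠ x₂) ×
       (∀ (u' : Func X P) → (p₁ ∘ᶠ u') ≈ᶠ x₁ → (p₂ ∘ᶠ u') ≈ᶠ x₂ → u' ≈ᶠ u))

record EqHyp : Set₁ where
  field
    E V Q : Setoid 0ℓ 0ℓ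
    s t   : Func E (V ⋆)
    q     : Func V Q
    q-surjective : Surjective q
open EqHyp public

record EqHypHom (G H : EqHyp) : Set where
  field
    hE : Func (E G) (E H)
    hV : Func (V G) (V H)
    hQ : Func (Q G) (Q H)
    s-comm : ((hV ⋆ᶠ) ∘ᶠ s G) ≈ᶠ (s H ∘ᶠ hE)
    t-comm : ((hV ⋆ᶠ) ∘ᶠ t G) ≈ᶠ (t H ∘ᶠ hE)
    q-comm : (hQ ∘ᶠ q G) ≈ᶠ (q H ∘ᶠ hV)
open EqHypHom public

_≈_ : {G H : EqHyp} → EqHypHom G H → EqHypHom G H → Set
h ≈ k = (hE h ≈ᶠ hE k) × (hV h ≈ᶠ hV k) × (hQ h ≈ᶠ hQ k)

infix 4 _≈_
infixr 9 _∘_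

private
  ⋆-comp : {X Y Z : Setoid 0ℓ 0ℓ} {W : Setoid 0ℓ 0ℓ}
    (g : Func Y Z) (f : Func X Y) (a : Func W (X ⋆)) (b : Func W (Y ⋆)) (c : Func W (Z ⋆)) →
    ((f ⋆ᶠ) ∘ᶠ a) ≈ᶠ b → ((g ⋆ᶠ) ∘ᶠ b) ≈ᶠ c → (((g ∘ᶠ f) ⋆ᶠ) ∘ᶠ a) ≈ᶠ c
  ⋆-comp {Z = Z} g f a b c p r w =
    Setoid.trans (Z ⋆)
      (Setoid.reflexive (Z ⋆) (map-∘ (to a w)))
      (Setoid.trans (Z ⋆) (cong (g ⋆ᶠ) (p w)) (r w))

_∘_ : {G H K : EqHyp} → EqHypHom H K → EqHypHom G H → EqHypHom G K
_∘_ {G} {H} {K} k h = record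
  { hE = hE k ∘ᶠ hE h
  ; hV = hV k ∘ᶠ hV h
  ; hQ = hQ k ∘ᶠ hQ h
  ; s-comm = λ e → ⋆-comp (hV k) (hV h) (s G) (s H ∘ᶠ hE h) (s K ∘ᶠ (hE k ∘ᶠ hE h))
                     (s-comm h) (λ e' → s-comm k (to (hE h) e')) e
  ; t-comm = λ e → ⋆-comp (hV k) (hV h) (t G) (t H ∘ᶠ hE h) (t K ∘ᶠ (hE k ∘ᶠ hE h))
                     (t-comm h) (λ e' → t-comm k (to (hE h) e')) e
  ; q-comm = λ v → Setoid.trans (Q K) (cong (hQ k) (q-comm h v)) (q-comm k (to (hV h) v))
  }

id : {G : EqHyp} → EqHypHom G G
id {G} = record
  { hE = idᶠ ; hV = idᶠ ; hQ = idᶠ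
  ; s-comm = λ e → Setoid.reflexive (V G ⋆) (Data.List.Properties.map-id (to (s G) e))
  ; t-comm = λ e → Setoid.reflexive (V G ⋆) (Data.List.Properties.map-id (to (t G) e))
  ; q-comm = λ v → Setoid.refl (Q G) }
  where import Data.List.Properties

Mono : {A B : EqHyp} → EqHypHom A B → Set₁
Mono {A} m = ∀ {X : EqHyp} (g h : EqHypHom X A) → m ∘ g ≈ m ∘ h → g ≈ h

IsIso : {A B : EqHyp} → EqHypHom A B → Set
IsIso {A} {B} f = Σ (EqHypHom B A) λ g → (g ∘ f ≈ id) × (f ∘ g ≈ id)

IsEqualizer : {X A B : EqHyp} → EqHypHom X A → EqHypHom A B → EqHypHom A B → Set₁
IsEqualizer {X} {A} e f g =
  (f ∘ e ≈ g ∘ e) ×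
  (∀ {Y : EqHyp} (h : EqHypHom Y A) → f ∘ h ≈ g ∘ h →
     Σ (EqHypHom Y X) λ u → (e ∘ u ≈ h) × (∀ (u' : EqHypHom Y X) → e ∘ u' ≈ h → u' ≈ u))

RegularMono : {X A : EqHyp} → EqHypHom X A → Set₁
RegularMono {X} {A} e = Σ EqHyp λ B → Σ (EqHypHom A B) λ f → Σ (EqHypHom A B) λ g →
  IsEqualizer e f g

-- Pullback square in EqHyp:
--   P --p₂--> C
--   |         |
--   p₁        g
--   v         v
--   B --f---> D
IsPullback : {P B C D : EqHyp} →
  EqHypHom B D → EqHypHom C D → EqHypHom P B → EqHypHom P C → Set₁
IsPullback {P} {B} {C} {D} f g p₁ p₂ =
  (f ∘ p₁ ≈ g ∘ p₂) ×
  (∀ {X : EqHyp} (x₁ : EqHypHom X B) (x₂ : EqHypHom X C) → f ∘ x₁ ≈ g ∘ x₂ →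
     Σ (EqHypHom X P) λ u → (p₁ ∘ u ≈ x₁) × (p₂ ∘ u ≈ x₂) ×
       (∀ (u' : EqHypHom X P) → p₁ ∘ u' ≈ x₁ → p₂ ∘ u' ≈ x₂ → u' ≈ u))

-- Pushout square in EqHyp:
--   A --f---> B
--   |         |
--   m         n
--   v         v
--   C --g---> D
IsPushout : {A B C D : EqHyp} →
  EqHypHom A B → EqHypHom A C → EqHypHom B D → EqHypHom C D → Set₁
IsPushout {A} {B} {C} {D} f m n g =
  (n ∘ f ≈ g ∘ m) ×
  (∀ {X : EqHyp} (y₁ : EqHypHom B X) (y₂ : EqHypHom C X) → y₁ ∘ f ≈ y₂ ∘ m →
     Σ (EqHypHom D X) λ u → (u ∘ n ≈ y₁) × (u ∘ g ≈ y₂) ×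
       (∀ (u' : EqHypHom D X) → u' ∘ n ≈ y₁ → u' ∘ g ≈ y₂ → u' ≈ u))

Pb : {G H : EqHyp} → EqHypHom G H → Set₁
Pb {G} {H} h = RegularMono h × IsSetPullback (q H) (hQ h) (hV h) (q G)

Class : Set₂
Class = ∀ {A B : EqHyp} → EqHypHom A B → Set₁

record AdmissibleClass (M : Class) : Set₁ where
  field
    monos         : ∀ {A B} (f : EqHypHom A B) → M f → Mono f
    isos          : ∀ {A B} (f : EqHypHom A B) → IsIso f → M f
    composition   : ∀ {A B C} (g : EqHypHom B C) (f : EqHypHom A B) → M g → M f → M (g ∘ f)
    decomposition : ∀ {A B C} (g : EqHypHom B C) (f : EqHypHom A B) → M g → M (g ∘ f) → M f
    -- pullback square (f, g, p₁, p₂) as in IsPullback: p₁ ∥ g, p₂ ∥ f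
    pullback-stable₁ : ∀ {P B C D} (f : EqHypHom B D) (g : EqHypHom C D)
      (p₁ : EqHypHom P B) (p₂ : EqHypHom P C) → IsPullback f g p₁ p₂ → M g → M p₁
    pullback-stable₂ : ∀ {P B C D} (f : EqHypHom B D) (g : EqHypHom C D)
      (p₁ : EqHypHom P B) (p₂ : EqHypHom P C) → IsPullback f g p₁ p₂ → M f → M p₂
    -- pushout square (f, m, n, g) as in IsPushout: n ∥ m, g ∥ f
    pushout-stable₁ : ∀ {A B C D} (f : EqHypHom A B) (m : EqHypHom A C)
      (n : EqHypHom B D) (g : EqHypHom C D) → IsPushout f m n g → M m → M n
    pushout-stable₂ : ∀ {A B C D} (f : EqHypHom A B) (m : EqHypHom A C)
      (n : EqHypHom B D) (g : EqHypHom C D) → IsPushout f m n g → M f → M g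

IsVanKampen : (𝒜 : Class) {A B C D : EqHyp} →
  EqHypHom A B → EqHypHom A C → EqHypHom B D → EqHypHom C D → Set₁
IsVanKampen 𝒜 {A} {B} {C} {D} f m n g =
  IsPushout f m n g ×
  (∀ {A' B' C' D' : EqHyp}
     (f' : EqHypHom A' B') (m' : EqHypHom A' C') (n' : EqHypHom B' D') (g' : EqHypHom C' D')
     (a : EqHypHom A' A) (b : EqHypHom B' B) (c : EqHypHom C' C) (d : EqHypHom D' D) →
     n' ∘ f' ≈ g' ∘ m' →      -- top
     f ∘ a ≈ b ∘ f' →         -- back
     m ∘ a ≈ c ∘ m' →         -- left
     g ∘ c ≈ d ∘ g' →         -- front
     n ∘ b ≈ d ∘ n' →         -- right
     -- back and left faces are pullbacks
     IsPullback f b a f' →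
     IsPullback m c a m' →
     𝒜 a → 𝒜 b → 𝒜 c → 𝒜 d →
     (IsPushout f' m' n' g' → IsPullback g d c g' × IsPullback n d b n') ×
     (IsPullback g d c g' × IsPullback n d b n' → IsPushout f' m' n' g'))

record IsMAdhesive (M : Class) : Set₂ where
  field
    admissible : AdmissibleClass M
    pullbacks-along-M : ∀ {B C D} (f : EqHypHom B D) (g : EqHypHom C D) → M g →
      Σ EqHyp λ P → Σ (EqHypHom P B) λ p₁ → Σ (EqHypHom P C) λ p₂ → IsPullback f g p₁ p₂
    pushouts-along-M : ∀ {A B C} (f : EqHypHom A B) (m : EqHypHom A C) → M m →
      Σ EqHyp λ D → Σ (EqHypHom B D) λ n → Σ (EqHypHom C D) λ g → IsPushout f m n g
    van-kampen : ∀ {A B C D} (f : EqHypHom A B) (m : EqHypHom A C)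
      (n : EqHypHom B D) (g : EqHypHom C D) →
      M m → IsPushout f m n g → IsVanKampen M f m n g

{-# OPTIONS --safe #-}
-- Pushouts in EqHyp are computed separately on edges, vertices and classes, and so are pullbacks
-- on edges and vertices; the classes of a pullback, however, are only the image of its vertices
-- in the product of the classes, so on classes a pullback merely has jointly injective
-- projections. A morphism lies in Pb iff it is injective on all three components and saturated:
-- a vertex whose class comes from the domain comes itself from the domain. The closure
-- properties of Pb then reduce to elementary facts about injections of setoids, and the Van
-- Kampen property to that of a pushout of setoids along an injection, in which two elements of
-- B ⊎ C are identified through at most one gluing step. Saturation of b and c carries the
-- pullback property of the back and left faces over to their classes.
module Submission where

open import Defs
open import Level using (0ℓ)
open import Relation.Binary.Bundles using (Setoid)
open import Data.List using ([]; _∷_)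
open import Data.List.Relation.Binary.Pointwise as List using ([]; _∷_)
open import Data.List.Properties using (map-∘; map-id)
open import Data.Product using (Σ; _×_; _,_; proj₁; proj₂)
open import Data.Sum using (_⊎_; inj₁; inj₂; [_,_]′)
open import Data.Sum.Relation.Binary.Pointwise as Sum using (inj₁; inj₂)
open import Data.Unit using (⊤; tt)
open import Data.Empty using (⊥)
open import Function.Bundles using (Func)
open import Function.Definitions using (Injective)
import Function.Construct.Constant as Constant
import Relation.Binary.PropositionalEquality as ≡
import Relation.Binary.Reasoning.Setoid as SetoidReasoning

open Setoid using (Carrier) renaming (_≈_ to [_]_≈_)
open Func using (to; cong)

Setoid₀ : Set₁
Setoid₀ = Setoid 0ℓ 0ℓ

refl[_] : (X : Setoid₀) {x : Carrier X} → [ X ] x ≈ x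
refl[ X ] = Setoid.refl X

sym[_] : (X : Setoid₀) {x y : Carrier X} → [ X ] x ≈ y → [ X ] y ≈ x
sym[ X ] = Setoid.sym X

trans[_] : (X : Setoid₀) {x y z : Carrier X} → [ X ] x ≈ y → [ X ] y ≈ z → [ X ] x ≈ z
trans[ X ] = Setoid.trans X

⊤ₛ ⊥ₛ : Setoid₀
⊤ₛ = ≡.setoid ⊤
⊥ₛ = ≡.setoid ⊥

const : (X : Setoid₀) → Carrier X → Func ⊤ₛ X
const = Constant.function ⊤ₛ

from⊥ : (X : Setoid₀) → Func ⊥ₛ X
from⊥ X = record { to = λ () ; cong = λ { {()} } }

Injectiveᶠ : {X Y : Setoid₀} → Func X Y → Set
Injectiveᶠ {X} {Y} f = Injective (Setoid._≈_ X) (Setoid._≈_ Y) (to f)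

JointlyInjective : {P X Y : Setoid₀} → Func P X → Func P Y → Set
JointlyInjective {P} {X} {Y} p₁ p₂ = ∀ {z z'} →
  [ X ] to p₁ z ≈ to p₁ z' → [ Y ] to p₂ z ≈ to p₂ z' → [ P ] z ≈ z'

Covers : {P X Y Z : Setoid₀} → Func X Z → Func Y Z → Func P X → Func P Y → Set
Covers {P} {X} {Y} {Z} f g p₁ p₂ = ∀ x y → [ Z ] to f x ≈ to g y →
  Σ (Carrier P) λ z → [ X ] to p₁ z ≈ x × [ Y ] to p₂ z ≈ y

jointlyInjective-factor : {W P X Y : Setoid₀} (p₁ : Func P X) (p₂ : Func P Y) → JointlyInjective p₁ p₂ →
  (x₁ : Func W X) (x₂ : Func W Y) (u : Carrier W → Carrier P) →
  (∀ w → [ X ] to p₁ (u w) ≈ to x₁ w) → (∀ w → [ Y ] to p₂ (u w) ≈ to x₂ w) → Func W P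
jointlyInjective-factor {X = X} {Y} p₁ p₂ p-inj x₁ x₂ u p₁u≈x₁ p₂u≈x₂ = record
  { to   = u
  ; cong = λ {w} {w'} w≈w' →
      p-inj (trans[ X ] (p₁u≈x₁ w) (trans[ X ] (cong x₁ w≈w') (sym[ X ] (p₁u≈x₁ w'))))
            (trans[ Y ] (p₂u≈x₂ w) (trans[ Y ] (cong x₂ w≈w') (sym[ Y ] (p₂u≈x₂ w'))))
  }

injective-factor : {W P X : Setoid₀} (p : Func P X) → Injectiveᶠ p →
  (x : Func W X) (u : Carrier W → Carrier P) → (∀ w → [ X ] to p (u w) ≈ to x w) → Func W P
injective-factor p p-inj x u pu≈x = jointlyInjective-factor p p (λ r _ → p-inj r) x x u pu≈x pu≈x

module _ {X Y : Setoid₀} where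

  ⋆ᶠ-injective : (f : Func X Y) → Injectiveᶠ f → Injectiveᶠ (f ⋆ᶠ)
  ⋆ᶠ-injective f f-inj r = List.map f-inj (List.map⁻ (to f) (to f) r)

  ⋆ᶠ-cong : {f g : Func X Y} → f ≈ᶠ g → (f ⋆ᶠ) ≈ᶠ (g ⋆ᶠ)
  ⋆ᶠ-cong {f} {g} f≈g []       = []
  ⋆ᶠ-cong {f} {g} f≈g (x ∷ xs) = f≈g x ∷ ⋆ᶠ-cong {f} {g} f≈g xs

  ⋆ᶠ-∘ : {Z : Setoid₀} (g : Func Y Z) (f : Func X Y) → ((g ∘ᶠ f) ⋆ᶠ) ≈ᶠ ((g ⋆ᶠ) ∘ᶠ (f ⋆ᶠ))
  ⋆ᶠ-∘ {Z} g f xs = Setoid.reflexive (Z ⋆) (map-∘ xs)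

module _ {P X Y : Setoid₀} {p₁ : Func P X} {p₂ : Func P Y} where

  ⋆ᶠ-jointlyInjective : JointlyInjective p₁ p₂ → JointlyInjective (p₁ ⋆ᶠ) (p₂ ⋆ᶠ)
  ⋆ᶠ-jointlyInjective ji {[]}    {[]}    []       []         = []
  ⋆ᶠ-jointlyInjective ji {_ ∷ _} {_ ∷ _} (r ∷ rs) (r' ∷ rs') = ji r r' ∷ ⋆ᶠ-jointlyInjective ji rs rs'

copair : {B C D : Setoid₀} → Func B D → Func C D → Carrier B ⊎ Carrier C → Carrier D
copair n g = [ to n , to g ]′

module SetoidPushout {A B C : Setoid₀} (f : Func A B) (m : Func A C) where

  infix 4 _∼_ _≋_

  data _∼_ : Carrier B ⊎ Carrier C → Carrier B ⊎ Carrier C → Set where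
    inl-cong : ∀ {b b'} → [ B ] b ≈ b' → inj₁ b ∼ inj₁ b'
    inr-cong : ∀ {c c'} → [ C ] c ≈ c' → inj₂ c ∼ inj₂ c'
    glue     : ∀ a → inj₁ (to f a) ∼ inj₂ (to m a)
    ∼-sym    : ∀ {x y} → x ∼ y → y ∼ x
    ∼-trans  : ∀ {x y z} → x ∼ y → y ∼ z → x ∼ z

  _≋_ : Carrier B ⊎ Carrier C → Carrier B ⊎ Carrier C → Set
  _≋_ = Sum.Pointwise (Setoid._≈_ B) (Setoid._≈_ C)

  ≋⇒∼ : ∀ {x y} → x ≋ y → x ∼ y
  ≋⇒∼ (inj₁ p) = inl-cong p
  ≋⇒∼ (inj₂ p) = inr-cong p

  ∼-refl : ∀ {x} → x ∼ x
  ∼-refl = ≋⇒∼ (Sum.⊎-refl refl[ B ] refl[ C ])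

  Pushout : Setoid₀
  Pushout = record
    { Carrier       = Carrier B ⊎ Carrier C
    ; _≈_           = _∼_
    ; isEquivalence = record { refl = ∼-refl ; sym = ∼-sym ; trans = ∼-trans }
    }

  inl : Func B Pushout
  inl = record { to = inj₁ ; cong = inl-cong }

  inr : Func C Pushout
  inr = record { to = inj₂ ; cong = inr-cong }

  module _ {X : Setoid₀} (h₁ : Func B X) (h₂ : Func C X)
           (h-glue : (h₁ ∘ᶠ f) ≈ᶠ (h₂ ∘ᶠ m)) where

    copair-cong : ∀ {x y} → x ∼ y → [ X ] copair h₁ h₂ x ≈ copair h₁ h₂ y
    copair-cong (inl-cong p)  = cong h₁ p
    copair-cong (inr-cong p)  = cong h₂ p
    copair-cong (glue a)      = h-glue a
    copair-cong (∼-sym r)     = sym[ X ] (copair-cong r)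
    copair-cong (∼-trans r s) = trans[ X ] (copair-cong r) (copair-cong s)

    copairᶠ : Func Pushout X
    copairᶠ = record { to = copair h₁ h₂ ; cong = copair-cong }

  Over : Carrier A → Carrier B ⊎ Carrier C → Set
  Over a (inj₁ b) = [ B ] to f a ≈ b
  Over a (inj₂ c) = [ C ] to m a ≈ c

  Over-resp-≋ : ∀ {a x y} → Over a x → x ≋ y → Over a y
  Over-resp-≋ p (inj₁ q) = trans[ B ] p q
  Over-resp-≋ p (inj₂ q) = trans[ C ] p q

  Over⇒∼ : ∀ {a} x → Over a x → inj₁ (to f a) ∼ x
  Over⇒∼     (inj₁ b) p = inl-cong p
  Over⇒∼ {a} (inj₂ c) p = ∼-trans (glue a) (inr-cong p)

  -- Along an injection the zigzags of _∼_ collapse to at most one gluing step.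
  module AlongInjection (m-injective : Injectiveᶠ m) where

    infix 4 _≃_

    data _≃_ (x y : Carrier B ⊎ Carrier C) : Set where
      same  : x ≋ y → x ≃ y
      glued : ∀ a a' → Over a x → Over a' y → [ B ] to f a ≈ to f a' → x ≃ y

    Over-unique : ∀ {a a'} x → Over a x → Over a' x → [ B ] to f a ≈ to f a'
    Over-unique (inj₁ b) p p' = trans[ B ] p (sym[ B ] p')
    Over-unique (inj₂ c) p p' = cong f (m-injective (trans[ C ] p (sym[ C ] p')))

    ≃-sym : ∀ {x y} → x ≃ y → y ≃ x
    ≃-sym (same p)             = same (Sum.⊎-symmetric sym[ B ] sym[ C ] p)
    ≃-sym (glued a a' p p' e) = glued a' a p' p (sym[ B ] e)

    ≃-trans : ∀ {x y z} → x ≃ y → y ≃ z → x ≃ z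
    ≃-trans (same p) (same q) = same (Sum.⊎-transitive trans[ B ] trans[ C ] p q)
    ≃-trans (same p) (glued a a' q q' e) =
      glued a a' (Over-resp-≋ q (Sum.⊎-symmetric sym[ B ] sym[ C ] p)) q' e
    ≃-trans (glued a a' p p' e) (same q) = glued a a' p (Over-resp-≋ p' q) e
    ≃-trans {y = y} (glued a₁ a₂ p₁ p₂ e) (glued a₃ a₄ p₃ p₄ e') =
      glued a₁ a₄ p₁ p₄ (trans[ B ] e (trans[ B ] (Over-unique y p₂ p₃) e'))

    ∼⇒≃ : ∀ {x y} → x ∼ y → x ≃ y
    ∼⇒≃ (inl-cong p)  = same (inj₁ p)
    ∼⇒≃ (inr-cong p)  = same (inj₂ p)
    ∼⇒≃ (glue a)      = glued a a refl[ B ] refl[ C ] refl[ B ]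
    ∼⇒≃ (∼-sym r)     = ≃-sym (∼⇒≃ r)
    ∼⇒≃ (∼-trans r s) = ≃-trans (∼⇒≃ r) (∼⇒≃ s)

    inl-injective : ∀ {b b'} → inj₁ b ∼ inj₁ b' → [ B ] b ≈ b'
    inl-injective r with ∼⇒≃ r
    ... | same (inj₁ p)        = p
    ... | glued a a' p p' e = trans[ B ] (sym[ B ] p) (trans[ B ] e p')

    inl∼inr⇒image : ∀ {b c} → inj₁ b ∼ inj₂ c → Σ (Carrier A) λ a → [ C ] to m a ≈ c
    inl∼inr⇒image r with ∼⇒≃ r
    ... | glued a a' p p' e = a' , p'

module _ {A B : Setoid₀} (h : Func A B) (h-injective : Injectiveᶠ h) where
  open SetoidPushout h h
  open AlongInjection h-injective

  cokernelPair-factor : {W : Setoid₀} (k : Func W B) → (∀ w → inj₁ (to k w) ∼ inj₂ (to k w)) →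
    Σ (Func W A) λ u → (h ∘ᶠ u) ≈ᶠ k
  cokernelPair-factor k k-equalizes =
    injective-factor h h-injective k (λ w → proj₁ (image w)) (λ w → proj₂ (image w)) , λ w → proj₂ (image w)
    where
    image = λ w → inl∼inr⇒image (k-equalizes w)

-- the comparison map from SetoidPushout.Pushout f m to D is well defined, surjective and injective
record IsSetoidPushout {A B C D : Setoid₀}
    (f : Func A B) (m : Func A C) (n : Func B D) (g : Func C D) : Set where
  open SetoidPushout f m
  field
    commutes : (n ∘ᶠ f) ≈ᶠ (g ∘ᶠ m)
    covers   : ∀ d → Σ (Carrier B ⊎ Carrier C) λ x → [ D ] copair n g x ≈ d
    kernel   : ∀ {x y} → [ D ] copair n g x ≈ copair n g y → x ∼ y

  jointly-epic : {X : Setoid₀} (φ ψ : Func D X) →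
    (φ ∘ᶠ n) ≈ᶠ (ψ ∘ᶠ n) → (φ ∘ᶠ g) ≈ᶠ (ψ ∘ᶠ g) → φ ≈ᶠ ψ
  jointly-epic {X} φ ψ φn≈ψn φg≈ψg d with covers d
  ... | x , x↦d = trans[ X ] (cong φ (sym[ D ] x↦d)) (trans[ X ] (on-summands x) (cong ψ x↦d))
    where
    on-summands : ∀ x → [ X ] to φ (copair n g x) ≈ to ψ (copair n g x)
    on-summands (inj₁ b) = φn≈ψn b
    on-summands (inj₂ c) = φg≈ψg c

  module Mediator {X : Setoid₀} (h₁ : Func B X) (h₂ : Func C X)
                  (h-glue : (h₁ ∘ᶠ f) ≈ᶠ (h₂ ∘ᶠ m)) where

    private
      preimage : Carrier D → Carrier B ⊎ Carrier C
      preimage d = proj₁ (covers d)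

      preimage-kernel : ∀ {d d'} → [ D ] d ≈ d' → preimage d ∼ preimage d'
      preimage-kernel {d} {d'} d≈d' =
        kernel (trans[ D ] (proj₂ (covers d)) (trans[ D ] d≈d' (sym[ D ] (proj₂ (covers d')))))

    mediator : Func D X
    mediator = record
      { to   = λ d → copair h₁ h₂ (preimage d)
      ; cong = λ {d} {d'} d≈d' →
          copair-cong h₁ h₂ h-glue {preimage d} {preimage d'} (preimage-kernel d≈d')
      }

    mediator-copair : ∀ x → [ X ] to mediator (copair n g x) ≈ copair h₁ h₂ x
    mediator-copair x =
      copair-cong h₁ h₂ h-glue {preimage (copair n g x)} {x} (kernel (proj₂ (covers (copair n g x))))

    mediator-n : (mediator ∘ᶠ n) ≈ᶠ h₁
    mediator-n b = mediator-copair (inj₁ b)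

    mediator-g : (mediator ∘ᶠ g) ≈ᶠ h₂
    mediator-g c = mediator-copair (inj₂ c)

    mediator-unique : (u : Func D X) → (u ∘ᶠ n) ≈ᶠ h₁ → (u ∘ᶠ g) ≈ᶠ h₂ → u ≈ᶠ mediator
    mediator-unique u un≈h₁ ug≈h₂ = jointly-epic u mediator
      (λ b → trans[ X ] (un≈h₁ b) (sym[ X ] (mediator-n b)))
      (λ c → trans[ X ] (ug≈h₂ c) (sym[ X ] (mediator-g c)))

module _ {A B C : Setoid₀} (f : Func A B) (m : Func A C) where
  open SetoidPushout f m

  pushout-isSetoidPushout : IsSetoidPushout f m inl inr
  pushout-isSetoidPushout = record
    { commutes = glue
    ; covers   = λ x → x , copair-inl-inr x
    ; kernel   = λ {x} {y} r → ∼-trans (∼-sym (copair-inl-inr x)) (∼-trans r (copair-inl-inr y))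
    }
    where
    copair-inl-inr : ∀ x → copair inl inr x ∼ x
    copair-inl-inr (inj₁ b) = ∼-refl
    copair-inl-inr (inj₂ c) = ∼-refl

isSetoidPushout-retract : {A B C D D₀ : Setoid₀} {f : Func A B} {m : Func A C}
  {n₀ : Func B D₀} {g₀ : Func C D₀} {n : Func B D} {g : Func C D}
  (u : Func D D₀) (w : Func D₀ D) → IsSetoidPushout f m n₀ g₀ →
  (u ∘ᶠ n) ≈ᶠ n₀ → (u ∘ᶠ g) ≈ᶠ g₀ → (w ∘ᶠ n₀) ≈ᶠ n → (w ∘ᶠ g₀) ≈ᶠ g → (w ∘ᶠ u) ≈ᶠ idᶠ →
  IsSetoidPushout f m n g
isSetoidPushout-retract {B = B} {C} {D} {D₀} {f} {m} {n₀} {g₀} {n} {g} u w po un≈n₀ ug≈g₀ wn₀≈n wg₀≈g wu≈id = record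
  { commutes = λ a → trans[ D ] (sym[ D ] (wn₀≈n (to f a)))
                       (trans[ D ] (cong w (IsSetoidPushout.commutes po a)) (wg₀≈g (to m a)))
  ; covers   = covers
  ; kernel   = λ {x} {y} r → IsSetoidPushout.kernel po {x} {y}
                 (trans[ D₀ ] (sym[ D₀ ] (u-copair x)) (trans[ D₀ ] (cong u r) (u-copair y)))
  }
  where
  u-copair : ∀ x → [ D₀ ] to u (copair n g x) ≈ copair n₀ g₀ x
  u-copair (inj₁ b) = un≈n₀ b
  u-copair (inj₂ c) = ug≈g₀ c

  w-copair : ∀ x → [ D ] to w (copair n₀ g₀ x) ≈ copair n g x
  w-copair (inj₁ b) = wn₀≈n b
  w-copair (inj₂ c) = wg₀≈g c

  covers : ∀ d → Σ (Carrier B ⊎ Carrier C) λ x → [ D ] copair n g x ≈ d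
  covers d with IsSetoidPushout.covers po (to u d)
  ... | x , x↦ud = x , trans[ D ] (sym[ D ] (w-copair x)) (trans[ D ] (cong w x↦ud) (wu≈id d))

record IsSetoidPullback {P X Y Z : Setoid₀}
    (f : Func X Z) (g : Func Y Z) (p₁ : Func P X) (p₂ : Func P Y) : Set where
  field
    commutes          : (f ∘ᶠ p₁) ≈ᶠ (g ∘ᶠ p₂)
    covers            : Covers f g p₁ p₂
    jointly-injective : JointlyInjective p₁ p₂

  module Mediator {W : Setoid₀} (x₁ : Func W X) (x₂ : Func W Y) (x-commutes : (f ∘ᶠ x₁) ≈ᶠ (g ∘ᶠ x₂)) where

    private
      lift : ∀ w → Σ (Carrier P) λ z → [ X ] to p₁ z ≈ to x₁ w × [ Y ] to p₂ z ≈ to x₂ w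
      lift w = covers (to x₁ w) (to x₂ w) (x-commutes w)

    mediator : Func W P
    mediator = jointlyInjective-factor p₁ p₂ jointly-injective x₁ x₂
      (λ w → proj₁ (lift w)) (λ w → proj₁ (proj₂ (lift w))) (λ w → proj₂ (proj₂ (lift w)))

    mediator-p₁ : (p₁ ∘ᶠ mediator) ≈ᶠ x₁
    mediator-p₁ w = proj₁ (proj₂ (lift w))

    mediator-p₂ : (p₂ ∘ᶠ mediator) ≈ᶠ x₂
    mediator-p₂ w = proj₂ (proj₂ (lift w))

module _ {P X Y Z : Setoid₀} {f : Func X Z} {g : Func Y Z} {p₁ : Func P X} {p₂ : Func P Y} where

  ⋆ᶠ-covers : Covers f g p₁ p₂ → Covers (f ⋆ᶠ) (g ⋆ᶠ) (p₁ ⋆ᶠ) (p₂ ⋆ᶠ)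
  ⋆ᶠ-covers cov []       []       []       = [] , [] , []
  ⋆ᶠ-covers cov (x ∷ xs) (y ∷ ys) (r ∷ rs) with cov x y r | ⋆ᶠ-covers cov xs ys rs
  ... | z , p , q | zs , ps , qs = z ∷ zs , p ∷ ps , q ∷ qs

  ⋆ᶠ-isSetoidPullback : IsSetoidPullback f g p₁ p₂ → IsSetoidPullback (f ⋆ᶠ) (g ⋆ᶠ) (p₁ ⋆ᶠ) (p₂ ⋆ᶠ)
  ⋆ᶠ-isSetoidPullback pb = record
    { commutes          = λ zs → trans[ Z ⋆ ] (sym[ Z ⋆ ] (⋆ᶠ-∘ f p₁ zs))
                            (trans[ Z ⋆ ] (⋆ᶠ-cong {f = f ∘ᶠ p₁} {g ∘ᶠ p₂} commutes zs) (⋆ᶠ-∘ g p₂ zs))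
    ; covers            = ⋆ᶠ-covers covers
    ; jointly-injective = ⋆ᶠ-jointlyInjective {p₁ = p₁} {p₂} jointly-injective
    }
    where open IsSetoidPullback pb

covers-section : {P P₀ X Y Z : Setoid₀} (f : Func X Z) (g : Func Y Z) (p₁ : Func P X) (p₂ : Func P Y)
  (π₁ : Func P₀ X) (π₂ : Func P₀ Y) (u : Func P₀ P) →
  Covers f g π₁ π₂ → (p₁ ∘ᶠ u) ≈ᶠ π₁ → (p₂ ∘ᶠ u) ≈ᶠ π₂ → Covers f g p₁ p₂
covers-section {X = X} {Y} _ _ _ _ _ _ u π-covers p₁u≈π₁ p₂u≈π₂ x y r with π-covers x y r
... | z , π₁z≈x , π₂z≈y = to u z , trans[ X ] (p₁u≈π₁ z) π₁z≈x , trans[ Y ] (p₂u≈π₂ z) π₂z≈y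

jointlyInjective-retraction : {P P₀ X Y : Setoid₀} (p₁ : Func P X) (p₂ : Func P Y)
  (π₁ : Func P₀ X) (π₂ : Func P₀ Y) (w : Func P P₀) (u : Func P₀ P) → JointlyInjective π₁ π₂ →
  (π₁ ∘ᶠ w) ≈ᶠ p₁ → (π₂ ∘ᶠ w) ≈ᶠ p₂ → (u ∘ᶠ w) ≈ᶠ idᶠ → JointlyInjective p₁ p₂
jointlyInjective-retraction {P} {P₀} {X} {Y} _ _ _ _ w u π-inj π₁w≈p₁ π₂w≈p₂ uw≈id {z} {z'} r r' =
    trans[ P ] (sym[ P ] (uw≈id z)) (trans[ P ] (cong u wz≈wz') (uw≈id z'))
    where
    wz≈wz' : [ P₀ ] to w z ≈ to w z'
    wz≈wz' = π-inj (trans[ X ] (π₁w≈p₁ z) (trans[ X ] r (sym[ X ] (π₁w≈p₁ z'))))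
                   (trans[ Y ] (π₂w≈p₂ z) (trans[ Y ] r' (sym[ Y ] (π₂w≈p₂ z'))))

module _ {P X Y Z : Setoid₀} (f : Func X Z) (g : Func Y Z) (p₁ : Func P X) (p₂ : Func P Y) where

  isSetPullback⇒isSetoidPullback : IsSetPullback f g p₁ p₂ → IsSetoidPullback f g p₁ p₂
  isSetPullback⇒isSetoidPullback (commutes , universal) = record
    { commutes          = commutes
    ; covers            = covers
    ; jointly-injective = jointly-injective
    }
    where
    covers : Covers f g p₁ p₂
    covers x y r with universal ⊤ₛ (const X x) (const Y y) (λ _ → r)
    ... | u , p₁u≈x , p₂u≈y , _ = to u tt , p₁u≈x tt , p₂u≈y tt

    jointly-injective : JointlyInjective p₁ p₂
    jointly-injective {z} {z'} r r' with universal ⊤ₛ (const X (to p₁ z)) (const Y (to p₂ z)) (λ _ → commutes z)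
    ... | _ , _ , _ , unique =
      trans[ P ] (unique (const P z) (λ _ → refl[ X ]) (λ _ → refl[ Y ]) tt)
                 (sym[ P ] (unique (const P z') (λ _ → sym[ X ] r) (λ _ → sym[ Y ] r') tt))

  isSetoidPullback⇒isSetPullback : IsSetoidPullback f g p₁ p₂ → IsSetPullback f g p₁ p₂
  isSetoidPullback⇒isSetPullback pb = commutes , λ W x₁ x₂ x-commutes →
    let open Mediator x₁ x₂ x-commutes in
    mediator , mediator-p₁ , mediator-p₂ , λ u p₁u≈x₁ p₂u≈x₂ w →
      jointly-injective (trans[ X ] (p₁u≈x₁ w) (sym[ X ] (mediator-p₁ w)))
                        (trans[ Y ] (p₂u≈x₂ w) (sym[ Y ] (mediator-p₂ w)))
    where open IsSetoidPullback pb

injective-pullback : {P X Y Z : Setoid₀} (f : Func X Z) (g : Func Y Z) (p₁ : Func P X) (p₂ : Func P Y) →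
  (f ∘ᶠ p₁) ≈ᶠ (g ∘ᶠ p₂) → JointlyInjective p₁ p₂ → Injectiveᶠ g → Injectiveᶠ p₁
injective-pullback {Z = Z} f g p₁ p₂ commutes p-inj g-inj {z} {z'} p₁z≈p₁z' =
  p-inj p₁z≈p₁z' (g-inj (trans[ Z ] (sym[ Z ] (commutes z)) (trans[ Z ] (cong f p₁z≈p₁z') (commutes z'))))

module SetoidPullback {X Y Z : Setoid₀} (f : Func X Z) (g : Func Y Z) where

  Pullback : Setoid₀
  Pullback = record
    { Carrier       = Σ (Carrier X × Carrier Y) λ (x , y) → [ Z ] to f x ≈ to g y
    ; _≈_           = λ ((x , y) , _) ((x' , y') , _) → [ X ] x ≈ x' × [ Y ] y ≈ y'
    ; isEquivalence = record
      { refl  = refl[ X ] , refl[ Y ]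
      ; sym   = λ (p , q) → sym[ X ] p , sym[ Y ] q
      ; trans = λ (p , q) (p' , q') → trans[ X ] p p' , trans[ Y ] q q'
      }
    }

  π₁ : Func Pullback X
  π₁ = record { to = λ ((x , _) , _) → x ; cong = proj₁ }

  π₂ : Func Pullback Y
  π₂ = record { to = λ ((_ , y) , _) → y ; cong = proj₂ }

  pullback-isSetoidPullback : IsSetoidPullback f g π₁ π₂
  pullback-isSetoidPullback = record
    { commutes          = proj₂
    ; covers            = λ x y r → ((x , y) , r) , refl[ X ] , refl[ Y ]
    ; jointly-injective = _,_
    }

private
  variable
    A B C D G H K P X : EqHyp

≈-refl : {h : EqHypHom G H} → h ≈ h
≈-refl {H = H} = (λ _ → refl[ E H ]) , (λ _ → refl[ V H ]) , (λ _ → refl[ Q H ])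

≈-sym : {h k : EqHypHom G H} → h ≈ k → k ≈ h
≈-sym {H = H} (e , v , q) = (λ x → sym[ E H ] (e x)) , (λ x → sym[ V H ] (v x)) , (λ x → sym[ Q H ] (q x))

≈-trans : {h k l : EqHypHom G H} → h ≈ k → k ≈ l → h ≈ l
≈-trans {H = H} (e , v , q) (e' , v' , q') =
  (λ x → trans[ E H ] (e x) (e' x)) , (λ x → trans[ V H ] (v x) (v' x)) , (λ x → trans[ Q H ] (q x) (q' x))

∘-congˡ : (h : EqHypHom H K) (k k' : EqHypHom G H) → k ≈ k' → h ∘ k ≈ h ∘ k'
∘-congˡ h _ _ (e , v , q) = (λ x → cong (hE h) (e x)) , (λ x → cong (hV h) (v x)) , (λ x → cong (hQ h) (q x))

∘-congʳ : (h h' : EqHypHom H K) (k : EqHypHom G H) → h ≈ h' → h ∘ k ≈ h' ∘ k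
∘-congʳ _ _ k (e , v , q) = (λ x → e (to (hE k) x)) , (λ x → v (to (hV k) x)) , (λ x → q (to (hQ k) x))

record Incidence : Set₁ where
  field
    attach  : (G : EqHyp) → Func (E G) (V G ⋆)
    natural : (h : EqHypHom G H) → ((hV h ⋆ᶠ) ∘ᶠ attach G) ≈ᶠ (attach H ∘ᶠ hE h)

  natural-factor : (p : EqHypHom P B) (x : EqHypHom X B) (uE : Func (E X) (E P)) (uV : Func (V X) (V P)) →
    (hE p ∘ᶠ uE) ≈ᶠ hE x → (hV p ∘ᶠ uV) ≈ᶠ hV x →
    ((hV p ⋆ᶠ) ∘ᶠ ((uV ⋆ᶠ) ∘ᶠ attach X)) ≈ᶠ ((hV p ⋆ᶠ) ∘ᶠ (attach P ∘ᶠ uE))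
  natural-factor {B = B} {X = X} p x uE uV pu≈x pv≈x e =
    trans[ V B ⋆ ] (sym[ V B ⋆ ] (⋆ᶠ-∘ (hV p) uV (to (attach X) e)))
    (trans[ V B ⋆ ] (⋆ᶠ-cong {f = hV p ∘ᶠ uV} {hV x} pv≈x (to (attach X) e))
    (trans[ V B ⋆ ] (natural x e)
    (trans[ V B ⋆ ] (cong (attach B) (sym[ E B ] (pu≈x e)))
                    (sym[ V B ⋆ ] (natural p (to uE e))))))

  natural-cofactor : (k : EqHypHom B D) (y : EqHypHom B X) (uE : Func (E D) (E X)) (uV : Func (V D) (V X)) →
    (uE ∘ᶠ hE k) ≈ᶠ hE y → (uV ∘ᶠ hV k) ≈ᶠ hV y →
    (((uV ⋆ᶠ) ∘ᶠ attach D) ∘ᶠ hE k) ≈ᶠ ((attach X ∘ᶠ uE) ∘ᶠ hE k)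
  natural-cofactor {B = B} {D = D} {X = X} k y uE uV uk≈y uv≈y b =
    trans[ V X ⋆ ] (cong (uV ⋆ᶠ) (sym[ V D ⋆ ] (natural k b)))
    (trans[ V X ⋆ ] (sym[ V X ⋆ ] (⋆ᶠ-∘ uV (hV k) (to (attach B) b)))
    (trans[ V X ⋆ ] (⋆ᶠ-cong {f = uV ∘ᶠ hV k} {hV y} uv≈y (to (attach B) b))
    (trans[ V X ⋆ ] (natural y b)
                    (cong (attach X) (sym[ E X ] (uk≈y b))))))

open Incidence

sources targets : Incidence
sources = record { attach = s ; natural = s-comm }
targets = record { attach = t ; natural = t-comm }

mkHom : (uE : Func (E G) (E H)) (uV : Func (V G) (V H)) (uQ : Func (Q G) (Q H)) →
  (∀ σ → ((uV ⋆ᶠ) ∘ᶠ attach σ G) ≈ᶠ (attach σ H ∘ᶠ uE)) → (uQ ∘ᶠ q G) ≈ᶠ (q H ∘ᶠ uV) → EqHypHom G H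
mkHom uE uV uQ u-natural u-q = record
  { hE = uE ; hV = uV ; hQ = uQ ; s-comm = u-natural sources ; t-comm = u-natural targets ; q-comm = u-q }

hQ-determined : (h k : EqHypHom G H) → hV h ≈ᶠ hV k → hQ h ≈ᶠ hQ k
hQ-determined {G} {H} h k h≈k y with q-surjective G y
... | v , qv≈y = begin
  to (hQ h) y            ≈⟨ cong (hQ h) (sym[ Q G ] qv≈y) ⟩
  to (hQ h) (to (q G) v) ≈⟨ q-comm h v ⟩
  to (q H) (to (hV h) v) ≈⟨ cong (q H) (h≈k v) ⟩
  to (q H) (to (hV k) v) ≈⟨ sym[ Q H ] (q-comm k v) ⟩
  to (hQ k) (to (q G) v) ≈⟨ cong (hQ k) qv≈y ⟩
  to (hQ k) y            ∎
  where open SetoidReasoning (Q H)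

inducedQ : Func (V X) (V P) → Carrier (Q X) → Carrier (Q P)
inducedQ {X} {P} uV y = to (q P) (to uV (proj₁ (q-surjective X y)))

module _ (p : EqHypHom P B) (x : EqHypHom X B) (uV : Func (V X) (V P)) (pu≈x : (hV p ∘ᶠ uV) ≈ᶠ hV x) where

  q-factor : ∀ v → [ Q B ] to (hQ p) (to (q P) (to uV v)) ≈ to (hQ x) (to (q X) v)
  q-factor v = trans[ Q B ] (q-comm p (to uV v))
                 (trans[ Q B ] (cong (q B) (pu≈x v)) (sym[ Q B ] (q-comm x v)))

  inducedQ-factor : ∀ y → [ Q B ] to (hQ p) (inducedQ {X} {P} uV y) ≈ to (hQ x) y
  inducedQ-factor y with q-surjective X y
  ... | v , qv≈y = trans[ Q B ] (q-factor v) (cong (hQ x) qv≈y)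

module _ (k : EqHypHom B D) (y : EqHypHom B X) (uV : Func (V D) (V X)) (uQ : Func (Q D) (Q X))
         (uk≈y : (uV ∘ᶠ hV k) ≈ᶠ hV y) (uQk≈y : (uQ ∘ᶠ hQ k) ≈ᶠ hQ y) where

  q-cofactor : ((uQ ∘ᶠ q D) ∘ᶠ hV k) ≈ᶠ ((q X ∘ᶠ uV) ∘ᶠ hV k)
  q-cofactor v = trans[ Q X ] (cong uQ (sym[ Q D ] (q-comm k v)))
                   (trans[ Q X ] (uQk≈y (to (q B) v))
                   (trans[ Q X ] (q-comm y v) (cong (q X) (sym[ V X ] (uk≈y v)))))

record ComponentwisePullback
    (f : EqHypHom B D) (g : EqHypHom C D) (p₁ : EqHypHom P B) (p₂ : EqHypHom P C) : Set where
  field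
    E-pullback          : IsSetoidPullback (hE f) (hE g) (hE p₁) (hE p₂)
    V-pullback          : IsSetoidPullback (hV f) (hV g) (hV p₁) (hV p₂)
    Q-jointly-injective : JointlyInjective (hQ p₁) (hQ p₂)

componentwise⇒pullback : {f : EqHypHom B D} {g : EqHypHom C D} {p₁ : EqHypHom P B} {p₂ : EqHypHom P C} →
  ComponentwisePullback f g p₁ p₂ → IsPullback f g p₁ p₂
componentwise⇒pullback {B} {D} {C} {P} {f} {g} {p₁} {p₂} pb = commutes , universal
  where
  open ComponentwisePullback pb
  module PE = IsSetoidPullback E-pullback
  module PV = IsSetoidPullback V-pullback

  commutes : f ∘ p₁ ≈ g ∘ p₂
  commutes = PE.commutes , PV.commutes , hQ-determined (f ∘ p₁) (g ∘ p₂) PV.commutes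

  universal : (x₁ : EqHypHom X B) (x₂ : EqHypHom X C) → f ∘ x₁ ≈ g ∘ x₂ →
    Σ (EqHypHom X P) λ u → (p₁ ∘ u ≈ x₁) × (p₂ ∘ u ≈ x₂) ×
      (∀ u' → p₁ ∘ u' ≈ x₁ → p₂ ∘ u' ≈ x₂ → u' ≈ u)
  universal {X} x₁ x₂ (x-commutesE , x-commutesV , _) =
    u , (ME.mediator-p₁ , MV.mediator-p₁ , uQ-p₁) , (ME.mediator-p₂ , MV.mediator-p₂ , uQ-p₂) ,
    λ u' (e₁ , v₁ , q₁) (e₂ , v₂ , q₂) →
      (λ x → PE.jointly-injective (trans[ E B ] (e₁ x) (sym[ E B ] (ME.mediator-p₁ x)))
                                  (trans[ E C ] (e₂ x) (sym[ E C ] (ME.mediator-p₂ x)))) ,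
      (λ x → PV.jointly-injective (trans[ V B ] (v₁ x) (sym[ V B ] (MV.mediator-p₁ x)))
                                  (trans[ V C ] (v₂ x) (sym[ V C ] (MV.mediator-p₂ x)))) ,
      (λ x → Q-jointly-injective (trans[ Q B ] (q₁ x) (sym[ Q B ] (uQ-p₁ x)))
                                 (trans[ Q C ] (q₂ x) (sym[ Q C ] (uQ-p₂ x))))
    where
    module ME = PE.Mediator (hE x₁) (hE x₂) x-commutesE
    module MV = PV.Mediator (hV x₁) (hV x₂) x-commutesV
    uE = ME.mediator
    uV = MV.mediator

    uQ-p₁ : ∀ y → [ Q B ] to (hQ p₁) (inducedQ {X} {P} uV y) ≈ to (hQ x₁) y
    uQ-p₁ = inducedQ-factor p₁ x₁ uV MV.mediator-p₁

    uQ-p₂ : ∀ y → [ Q C ] to (hQ p₂) (inducedQ {X} {P} uV y) ≈ to (hQ x₂) y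
    uQ-p₂ = inducedQ-factor p₂ x₂ uV MV.mediator-p₂

    uQ : Func (Q X) (Q P)
    uQ = jointlyInjective-factor (hQ p₁) (hQ p₂) Q-jointly-injective (hQ x₁) (hQ x₂) (inducedQ {X} {P} uV) uQ-p₁ uQ-p₂

    u : EqHypHom X P
    u = mkHom uE uV uQ
      (λ σ e → ⋆ᶠ-jointlyInjective {p₁ = hV p₁} {hV p₂} PV.jointly-injective
        (natural-factor σ p₁ x₁ uE uV ME.mediator-p₁ MV.mediator-p₁ e)
        (natural-factor σ p₂ x₂ uE uV ME.mediator-p₂ MV.mediator-p₂ e))
      (λ v → Q-jointly-injective
        (trans[ Q B ] (uQ-p₁ (to (q X) v)) (sym[ Q B ] (q-factor p₁ x₁ uV MV.mediator-p₁ v)))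
        (trans[ Q C ] (uQ-p₂ (to (q X) v)) (sym[ Q C ] (q-factor p₂ x₂ uV MV.mediator-p₂ v))))

module EqHypPullback (f : EqHypHom B D) (g : EqHypHom C D) where
  module PE = SetoidPullback (hE f) (hE g)
  module PV = SetoidPullback (hV f) (hV g)

  -- the image of the vertices in Q B × Q C, rather than the pullback of Q B and Q C
  Qᴾ : Setoid₀
  Qᴾ = record
    { Carrier       = Carrier PV.Pullback
    ; _≈_           = λ ((v , w) , _) ((v' , w') , _) →
                        [ Q B ] to (q B) v ≈ to (q B) v' × [ Q C ] to (q C) w ≈ to (q C) w'
    ; isEquivalence = record
      { refl  = refl[ Q B ] , refl[ Q C ]
      ; sym   = λ (p , p') → sym[ Q B ] p , sym[ Q C ] p'
      ; trans = λ (p , p') (r , r') → trans[ Q B ] p r , trans[ Q C ] p' r'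
      }
    }

  module Attach (σ : Incidence) = IsSetoidPullback.Mediator
    (⋆ᶠ-isSetoidPullback PV.pullback-isSetoidPullback)
    (attach σ B ∘ᶠ PE.π₁) (attach σ C ∘ᶠ PE.π₂)
    (λ ((b , c) , r) → trans[ V D ⋆ ] (natural σ f b)
                         (trans[ V D ⋆ ] (cong (attach σ D) r) (sym[ V D ⋆ ] (natural σ g c))))

  Pullback : EqHyp
  Pullback = record
    { E            = PE.Pullback
    ; V            = PV.Pullback
    ; Q            = Qᴾ
    ; s            = Attach.mediator sources
    ; t            = Attach.mediator targets
    ; q            = record { to = λ v → v ; cong = λ (r , r') → cong (q B) r , cong (q C) r' }
    ; q-surjective = λ y → y , refl[ Q B ] , refl[ Q C ]
    }

  π₁ : EqHypHom Pullback B
  π₁ = record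
    { hE     = PE.π₁
    ; hV     = PV.π₁
    ; hQ     = record { to = λ ((v , _) , _) → to (q B) v ; cong = proj₁ }
    ; s-comm = Attach.mediator-p₁ sources
    ; t-comm = Attach.mediator-p₁ targets
    ; q-comm = λ _ → refl[ Q B ]
    }

  π₂ : EqHypHom Pullback C
  π₂ = record
    { hE     = PE.π₂
    ; hV     = PV.π₂
    ; hQ     = record { to = λ ((_ , w) , _) → to (q C) w ; cong = proj₂ }
    ; s-comm = Attach.mediator-p₂ sources
    ; t-comm = Attach.mediator-p₂ targets
    ; q-comm = λ _ → refl[ Q C ]
    }

  componentwise : ComponentwisePullback f g π₁ π₂
  componentwise = record
    { E-pullback          = PE.pullback-isSetoidPullback
    ; V-pullback          = PV.pullback-isSetoidPullback
    ; Q-jointly-injective = _,_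
    }

  pullback : IsPullback f g π₁ π₂
  pullback = componentwise⇒pullback componentwise

pullback-endo≈id : {f : EqHypHom B D} {g : EqHypHom C D} {p₁ : EqHypHom P B} {p₂ : EqHypHom P C} →
  IsPullback f g p₁ p₂ → (u : EqHypHom P P) → p₁ ∘ u ≈ p₁ → p₂ ∘ u ≈ p₂ → u ≈ id
pullback-endo≈id {p₁ = p₁} {p₂} (commutes , universal) u p₁u≈p₁ p₂u≈p₂ =
  ≈-trans {h = u} {mediator} {id} (unique u p₁u≈p₁ p₂u≈p₂) (≈-sym {h = id} {mediator} (unique id (≈-refl {h = p₁}) (≈-refl {h = p₂})))
  where
  mediator = proj₁ (universal p₁ p₂ commutes)
  unique   = proj₂ (proj₂ (proj₂ (universal p₁ p₂ commutes)))

componentwisePullback-retract : {P₀ : EqHyp} {f : EqHypHom B D} {g : EqHypHom C D}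
  {π₁ : EqHypHom P₀ B} {π₂ : EqHypHom P₀ C} (p₁ : EqHypHom P B) (p₂ : EqHypHom P C) →
  ComponentwisePullback f g π₁ π₂ → (u : EqHypHom P₀ P) (w : EqHypHom P P₀) → f ∘ p₁ ≈ g ∘ p₂ →
  p₁ ∘ u ≈ π₁ → p₂ ∘ u ≈ π₂ → π₁ ∘ w ≈ p₁ → π₂ ∘ w ≈ p₂ → u ∘ w ≈ id → ComponentwisePullback f g p₁ p₂
componentwisePullback-retract {f = f} {g} {π₁} {π₂} p₁ p₂ pb₀ u w (cE , cV , _) (uE₁ , uV₁ , _) (uE₂ , uV₂ , _)
                              (wE₁ , wV₁ , wQ₁) (wE₂ , wV₂ , wQ₂) (uwE , uwV , uwQ) = record
  { E-pullback          = record
    { commutes          = cE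
    ; covers            = covers-section (hE f) (hE g) (hE p₁) (hE p₂) (hE π₁) (hE π₂) (hE u) PE.covers uE₁ uE₂
    ; jointly-injective = jointlyInjective-retraction (hE p₁) (hE p₂) (hE π₁) (hE π₂) (hE w) (hE u) PE.jointly-injective wE₁ wE₂ uwE
    }
  ; V-pullback          = record
    { commutes          = cV
    ; covers            = covers-section (hV f) (hV g) (hV p₁) (hV p₂) (hV π₁) (hV π₂) (hV u) PV.covers uV₁ uV₂
    ; jointly-injective = jointlyInjective-retraction (hV p₁) (hV p₂) (hV π₁) (hV π₂) (hV w) (hV u) PV.jointly-injective wV₁ wV₂ uwV
    }
  ; Q-jointly-injective = jointlyInjective-retraction (hQ p₁) (hQ p₂) (hQ π₁) (hQ π₂) (hQ w) (hQ u) Q-jointly-injective wQ₁ wQ₂ uwQ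
  }
  where
  open ComponentwisePullback pb₀
  module PE = IsSetoidPullback E-pullback
  module PV = IsSetoidPullback V-pullback

pullback⇒componentwise : {f : EqHypHom B D} {g : EqHypHom C D} {p₁ : EqHypHom P B} {p₂ : EqHypHom P C} →
  IsPullback f g p₁ p₂ → ComponentwisePullback f g p₁ p₂
pullback⇒componentwise {f = f} {g} {p₁} {p₂} pb@(commutes , universal)
  with universal π₁ π₂ (proj₁ pullback) | proj₂ pullback p₁ p₂ commutes
  where open EqHypPullback f g
... | u , p₁u≈π₁ , p₂u≈π₂ , _ | w , π₁w≈p₁ , π₂w≈p₂ , _ =
  componentwisePullback-retract p₁ p₂ componentwise u w commutes p₁u≈π₁ p₂u≈π₂ π₁w≈p₁ π₂w≈p₂
    (pullback-endo≈id {f = f} {g} {p₁} {p₂} pb (u ∘ w)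
      (≈-trans {h = p₁ ∘ (u ∘ w)} {π₁ ∘ w} {p₁} (∘-congʳ (p₁ ∘ u) π₁ w p₁u≈π₁) π₁w≈p₁)
      (≈-trans {h = p₂ ∘ (u ∘ w)} {π₂ ∘ w} {p₂} (∘-congʳ (p₂ ∘ u) π₂ w p₂u≈π₂) π₂w≈p₂))
  where open EqHypPullback f g

record ComponentwisePushout
    (f : EqHypHom A B) (m : EqHypHom A C) (n : EqHypHom B D) (g : EqHypHom C D) : Set where
  field
    E-pushout : IsSetoidPushout (hE f) (hE m) (hE n) (hE g)
    V-pushout : IsSetoidPushout (hV f) (hV m) (hV n) (hV g)
    Q-pushout : IsSetoidPushout (hQ f) (hQ m) (hQ n) (hQ g)

componentwise⇒pushout : {f : EqHypHom A B} {m : EqHypHom A C} {n : EqHypHom B D} {g : EqHypHom C D} →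
  ComponentwisePushout f m n g → IsPushout f m n g
componentwise⇒pushout {A} {B} {C} {D} {f} {m} {n} {g} po =
  (PE.commutes , PV.commutes , PQ.commutes) , universal
  where
  open ComponentwisePushout po
  module PE = IsSetoidPushout E-pushout
  module PV = IsSetoidPushout V-pushout
  module PQ = IsSetoidPushout Q-pushout

  universal : (y₁ : EqHypHom B X) (y₂ : EqHypHom C X) → y₁ ∘ f ≈ y₂ ∘ m →
    Σ (EqHypHom D X) λ u → (u ∘ n ≈ y₁) × (u ∘ g ≈ y₂) ×
      (∀ u' → u' ∘ n ≈ y₁ → u' ∘ g ≈ y₂ → u' ≈ u)
  universal {X} y₁ y₂ (y-glueE , y-glueV , y-glueQ) =
    u , (ME.mediator-n , MV.mediator-n , MQ.mediator-n) , (ME.mediator-g , MV.mediator-g , MQ.mediator-g) ,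
    λ u' (e₁ , v₁ , q₁) (e₂ , v₂ , q₂) →
      ME.mediator-unique (hE u') e₁ e₂ , MV.mediator-unique (hV u') v₁ v₂ , MQ.mediator-unique (hQ u') q₁ q₂
    where
    module ME = PE.Mediator (hE y₁) (hE y₂) y-glueE
    module MV = PV.Mediator (hV y₁) (hV y₂) y-glueV
    module MQ = PQ.Mediator (hQ y₁) (hQ y₂) y-glueQ

    u : EqHypHom D X
    u = mkHom ME.mediator MV.mediator MQ.mediator
      (λ σ → PE.jointly-epic ((MV.mediator ⋆ᶠ) ∘ᶠ attach σ D) (attach σ X ∘ᶠ ME.mediator)
        (natural-cofactor σ n y₁ ME.mediator MV.mediator ME.mediator-n MV.mediator-n)
        (natural-cofactor σ g y₂ ME.mediator MV.mediator ME.mediator-g MV.mediator-g))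
      (PV.jointly-epic (MQ.mediator ∘ᶠ q D) (q X ∘ᶠ MV.mediator)
        (q-cofactor n y₁ MV.mediator MQ.mediator MV.mediator-n MQ.mediator-n)
        (q-cofactor g y₂ MV.mediator MQ.mediator MV.mediator-g MQ.mediator-g))

module EqHypPushout (f : EqHypHom A B) (m : EqHypHom A C) where
  module PE = SetoidPushout (hE f) (hE m)
  module PV = SetoidPushout (hV f) (hV m)
  module PQ = SetoidPushout (hQ f) (hQ m)

  attachᴾ : Incidence → Func PE.Pushout (PV.Pushout ⋆)
  attachᴾ σ = PE.copairᶠ ((PV.inl ⋆ᶠ) ∘ᶠ attach σ B) ((PV.inr ⋆ᶠ) ∘ᶠ attach σ C) glue⋆
    where
    glue⋆ : ∀ a → [ PV.Pushout ⋆ ] to (PV.inl ⋆ᶠ) (to (attach σ B) (to (hE f) a))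
                                  ≈ to (PV.inr ⋆ᶠ) (to (attach σ C) (to (hE m) a))
    glue⋆ a = begin
      to (PV.inl ⋆ᶠ) (to (attach σ B) (to (hE f) a))      ≈⟨ cong (PV.inl ⋆ᶠ) (sym[ V B ⋆ ] (natural σ f a)) ⟩
      to (PV.inl ⋆ᶠ) (to (hV f ⋆ᶠ) (to (attach σ A) a))   ≈⟨ sym[ PV.Pushout ⋆ ] (⋆ᶠ-∘ PV.inl (hV f) _) ⟩
      to ((PV.inl ∘ᶠ hV f) ⋆ᶠ) (to (attach σ A) a)        ≈⟨ ⋆ᶠ-cong {f = PV.inl ∘ᶠ hV f} {PV.inr ∘ᶠ hV m} PV.glue _ ⟩
      to ((PV.inr ∘ᶠ hV m) ⋆ᶠ) (to (attach σ A) a)        ≈⟨ ⋆ᶠ-∘ PV.inr (hV m) _ ⟩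
      to (PV.inr ⋆ᶠ) (to (hV m ⋆ᶠ) (to (attach σ A) a))   ≈⟨ cong (PV.inr ⋆ᶠ) (natural σ m a) ⟩
      to (PV.inr ⋆ᶠ) (to (attach σ C) (to (hE m) a))      ∎
      where open SetoidReasoning (PV.Pushout ⋆)

  qᴾ : Func PV.Pushout PQ.Pushout
  qᴾ = PV.copairᶠ (PQ.inl ∘ᶠ q B) (PQ.inr ∘ᶠ q C) λ a →
    PQ.∼-trans (PQ.inl-cong (sym[ Q B ] (q-comm f a)))
      (PQ.∼-trans (PQ.glue (to (q A) a)) (PQ.inr-cong (q-comm m a)))

  Pushout : EqHyp
  Pushout = record
    { E            = PE.Pushout
    ; V            = PV.Pushout
    ; Q            = PQ.Pushout
    ; s            = attachᴾ sources
    ; t            = attachᴾ targets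
    ; q            = qᴾ
    ; q-surjective = λ where
        (inj₁ y) → let (v , qv≈y) = q-surjective B y in inj₁ v , PQ.inl-cong qv≈y
        (inj₂ y) → let (v , qv≈y) = q-surjective C y in inj₂ v , PQ.inr-cong qv≈y
    }

  ι₁ : EqHypHom B Pushout
  ι₁ = record
    { hE = PE.inl ; hV = PV.inl ; hQ = PQ.inl
    ; s-comm = λ _ → refl[ PV.Pushout ⋆ ] ; t-comm = λ _ → refl[ PV.Pushout ⋆ ] ; q-comm = λ _ → PQ.∼-refl }

  ι₂ : EqHypHom C Pushout
  ι₂ = record
    { hE = PE.inr ; hV = PV.inr ; hQ = PQ.inr
    ; s-comm = λ _ → refl[ PV.Pushout ⋆ ] ; t-comm = λ _ → refl[ PV.Pushout ⋆ ] ; q-comm = λ _ → PQ.∼-refl }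

  componentwise : ComponentwisePushout f m ι₁ ι₂
  componentwise = record
    { E-pushout = pushout-isSetoidPushout (hE f) (hE m)
    ; V-pushout = pushout-isSetoidPushout (hV f) (hV m)
    ; Q-pushout = pushout-isSetoidPushout (hQ f) (hQ m)
    }

  pushout : IsPushout f m ι₁ ι₂
  pushout = componentwise⇒pushout componentwise

pushout-endo≈id : {f : EqHypHom A B} {m : EqHypHom A C} {n : EqHypHom B D} {g : EqHypHom C D} →
  IsPushout f m n g → (u : EqHypHom D D) → u ∘ n ≈ n → u ∘ g ≈ g → u ≈ id
pushout-endo≈id {n = n} {g} (commutes , universal) u un≈n ug≈g =
  ≈-trans {h = u} {mediator} {id} (unique u un≈n ug≈g) (≈-sym {h = id} {mediator} (unique id (≈-refl {h = n}) (≈-refl {h = g})))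
  where
  mediator = proj₁ (universal n g commutes)
  unique   = proj₂ (proj₂ (proj₂ (universal n g commutes)))

componentwisePushout-retract : {D₀ : EqHyp} {f : EqHypHom A B} {m : EqHypHom A C}
  {ι₁ : EqHypHom B D₀} {ι₂ : EqHypHom C D₀} (n : EqHypHom B D) (g : EqHypHom C D) →
  ComponentwisePushout f m ι₁ ι₂ → (u : EqHypHom D D₀) (w : EqHypHom D₀ D) →
  u ∘ n ≈ ι₁ → u ∘ g ≈ ι₂ → w ∘ ι₁ ≈ n → w ∘ ι₂ ≈ g → w ∘ u ≈ id → ComponentwisePushout f m n g
componentwisePushout-retract n g po₀ u w (uE₁ , uV₁ , uQ₁) (uE₂ , uV₂ , uQ₂) (wE₁ , wV₁ , wQ₁) (wE₂ , wV₂ , wQ₂)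
                             (wuE , wuV , wuQ) = record
  { E-pushout = isSetoidPushout-retract (hE u) (hE w) E-pushout uE₁ uE₂ wE₁ wE₂ wuE
  ; V-pushout = isSetoidPushout-retract (hV u) (hV w) V-pushout uV₁ uV₂ wV₁ wV₂ wuV
  ; Q-pushout = isSetoidPushout-retract (hQ u) (hQ w) Q-pushout uQ₁ uQ₂ wQ₁ wQ₂ wuQ
  }
  where open ComponentwisePushout po₀

pushout⇒componentwise : {f : EqHypHom A B} {m : EqHypHom A C} {n : EqHypHom B D} {g : EqHypHom C D} →
  IsPushout f m n g → ComponentwisePushout f m n g
pushout⇒componentwise {f = f} {m} {n} {g} po@(commutes , universal)
  with universal ι₁ ι₂ (proj₁ pushout) | proj₂ pushout n g commutes
  where open EqHypPushout f m
... | u , un≈ι₁ , ug≈ι₂ , _ | w , wι₁≈n , wι₂≈g , _ =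
  componentwisePushout-retract n g componentwise u w un≈ι₁ ug≈ι₂ wι₁≈n wι₂≈g
    (pushout-endo≈id {f = f} {m} {n} {g} po (w ∘ u)
      (≈-trans {h = w ∘ (u ∘ n)} {w ∘ ι₁} {n} (∘-congˡ w (u ∘ n) ι₁ un≈ι₁) wι₁≈n)
      (≈-trans {h = w ∘ (u ∘ g)} {w ∘ ι₂} {g} (∘-congˡ w (u ∘ g) ι₂ ug≈ι₂) wι₂≈g))
  where open EqHypPushout f m

regularMono⇒mono : (e : EqHypHom G H) → RegularMono e → Mono e
regularMono⇒mono e (_ , f , g , fe≈ge , universal) k l ek≈el =
  ≈-trans {h = k} {mediator} {l} (unique k (≈-refl {h = e ∘ k})) (≈-sym {h = l} {mediator} (unique l (≈-sym {h = e ∘ k} {e ∘ l} ek≈el)))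
  where
  f∘ek≈g∘ek : f ∘ (e ∘ k) ≈ g ∘ (e ∘ k)
  f∘ek≈g∘ek = ∘-congʳ (f ∘ e) (g ∘ e) k fe≈ge
  mediator = proj₁ (universal (e ∘ k) f∘ek≈g∘ek)
  unique   = proj₂ (proj₂ (universal (e ∘ k) f∘ek≈g∘ek))

Vertex : EqHyp
Vertex = record
  { E = ⊥ₛ ; V = ⊤ₛ ; Q = ⊤ₛ ; s = from⊥ _ ; t = from⊥ _ ; q = const ⊤ₛ tt ; q-surjective = λ _ → tt , ≡.refl }

vertex : (G : EqHyp) → Carrier (V G) → EqHypHom Vertex G
vertex G v = record
  { hE = from⊥ _ ; hV = const (V G) v ; hQ = const (Q G) (to (q G) v)
  ; s-comm = λ () ; t-comm = λ () ; q-comm = λ _ → refl[ Q G ] }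

Edge : (G : EqHyp) → Carrier (E G) → EqHyp
Edge G e = record
  { E = ⊤ₛ ; V = V G ; Q = Q G ; s = const _ (to (s G) e) ; t = const _ (to (t G) e) ; q = q G
  ; q-surjective = q-surjective G }

edge : (G : EqHyp) (e e' : Carrier (E G)) → [ V G ⋆ ] to (s G) e ≈ to (s G) e' → [ V G ⋆ ] to (t G) e ≈ to (t G) e' →
  EqHypHom (Edge G e) G
edge G e e' se≈se' te≈te' = record
  { hE = const _ e' ; hV = idᶠ ; hQ = idᶠ
  ; s-comm = λ _ → trans[ V G ⋆ ] (Setoid.reflexive (V G ⋆) (map-id _)) se≈se'
  ; t-comm = λ _ → trans[ V G ⋆ ] (Setoid.reflexive (V G ⋆) (map-id _)) te≈te'
  ; q-comm = λ _ → refl[ Q G ] }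

attach-reflects : (σ : Incidence) (h : EqHypHom G H) → Injectiveᶠ (hV h) →
  ∀ {e e'} → [ E H ] to (hE h) e ≈ to (hE h) e' → [ V G ⋆ ] to (attach σ G) e ≈ to (attach σ G) e'
attach-reflects {G} {H} σ h hV-inj {e} {e'} he≈he' = ⋆ᶠ-injective (hV h) hV-inj
  (trans[ V H ⋆ ] (natural σ h e) (trans[ V H ⋆ ] (cong (attach σ H) he≈he') (sym[ V H ⋆ ] (natural σ h e'))))

mono⇒V-injective : (h : EqHypHom G H) → Mono h → Injectiveᶠ (hV h)
mono⇒V-injective {G} {H} h h-mono {v} {v'} hv≈hv' =
  proj₁ (proj₂ (h-mono (vertex G v) (vertex G v') ((λ ()) , (λ _ → hv≈hv') , λ _ → hQ-cong))) tt
  where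
  hQ-cong : [ Q H ] to (hQ h) (to (q G) v) ≈ to (hQ h) (to (q G) v')
  hQ-cong = trans[ Q H ] (q-comm h v) (trans[ Q H ] (cong (q H) hv≈hv') (sym[ Q H ] (q-comm h v')))

mono⇒E-injective : (h : EqHypHom G H) → Mono h → Injectiveᶠ (hE h)
mono⇒E-injective {G} {H} h h-mono {e} {e'} he≈he' =
  proj₁ (h-mono (edge G e e refl[ V G ⋆ ] refl[ V G ⋆ ]) (edge G e e' (same-attachment sources) (same-attachment targets))
                ((λ _ → he≈he') , (λ _ → refl[ V H ]) , (λ _ → refl[ Q H ]))) tt
  where
  same-attachment : (σ : Incidence) → [ V G ⋆ ] to (attach σ G) e ≈ to (attach σ G) e'
  same-attachment σ = attach-reflects σ h (mono⇒V-injective h h-mono) he≈he'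

record SaturatedEmbedding (h : EqHypHom G H) : Set where
  field
    E-injective : Injectiveᶠ (hE h)
    V-injective : Injectiveᶠ (hV h)
    Q-injective : Injectiveᶠ (hQ h)
    saturated   : ∀ v y → [ Q H ] to (q H) v ≈ to (hQ h) y → Σ (Carrier (V G)) λ w → [ V H ] to (hV h) w ≈ v

Pb⇒saturated : (h : EqHypHom G H) → Pb h → SaturatedEmbedding h
Pb⇒saturated {G} {H} h (h-regular , h-pullback) = record
  { E-injective = mono⇒E-injective h h-mono
  ; V-injective = V-injective
  ; Q-injective = Q-injective
  ; saturated   = λ v y r → let (w , hw≈v , _) = covers v y r in w , hw≈v
  }
  where
  h-mono = regularMono⇒mono h h-regular
  V-injective = mono⇒V-injective h h-mono
  open IsSetoidPullback (isSetPullback⇒isSetoidPullback (q H) (hQ h) (hV h) (q G) h-pullback)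

  Q-injective : Injectiveᶠ (hQ h)
  Q-injective {y} {y'} hy≈hy' with q-surjective G y
  ... | v , qv≈y with covers (to (hV h) v) y'
                      (trans[ Q H ] (sym[ Q H ] (q-comm h v)) (trans[ Q H ] (cong (hQ h) qv≈y) hy≈hy'))
  ... | w , hw≈hv , qw≈y' =
    trans[ Q G ] (sym[ Q G ] qv≈y) (trans[ Q G ] (cong (q G) (V-injective (sym[ V H ] hw≈hv))) qw≈y')

saturated⇒Pb : (h : EqHypHom G H) → SaturatedEmbedding h → Pb h
saturated⇒Pb {G} {H} h sat =
  (Pushout , ι₁ , ι₂ , proj₁ pushout , equalizer) ,
  isSetoidPullback⇒isSetPullback (q H) (hQ h) (hV h) (q G) (record
    { commutes          = λ v → sym[ Q H ] (q-comm h v)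
    ; covers            = covers
    ; jointly-injective = λ r _ → V-injective r
    })
  where
  open SaturatedEmbedding sat
  open EqHypPushout h h

  covers : Covers (q H) (hQ h) (hV h) (q G)
  covers v y r with saturated v y r
  ... | w , hw≈v = w , hw≈v ,
    Q-injective (trans[ Q H ] (q-comm h w) (trans[ Q H ] (cong (q H) hw≈v) r))

  equalizer : (k : EqHypHom X H) → ι₁ ∘ k ≈ ι₂ ∘ k →
    Σ (EqHypHom X G) λ u → (h ∘ u ≈ k) × (∀ u' → h ∘ u' ≈ k → u' ≈ u)
  equalizer {X} k (kE , kV , kQ)
    with cokernelPair-factor (hE h) E-injective (hE k) kE
       | cokernelPair-factor (hV h) V-injective (hV k) kV
       | cokernelPair-factor (hQ h) Q-injective (hQ k) kQ
  ... | uE , hu≈kE | uV , hu≈kV | uQ , hu≈kQ =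
    u , (hu≈kE , hu≈kV , hu≈kQ) , λ u' (e , v , r) →
      (λ x → E-injective (trans[ E H ] (e x) (sym[ E H ] (hu≈kE x)))) ,
      (λ x → V-injective (trans[ V H ] (v x) (sym[ V H ] (hu≈kV x)))) ,
      (λ x → Q-injective (trans[ Q H ] (r x) (sym[ Q H ] (hu≈kQ x))))
    where
    u : EqHypHom X G
    u = mkHom uE uV uQ
      (λ σ e → ⋆ᶠ-injective (hV h) V-injective (natural-factor σ h k uE uV hu≈kE hu≈kV e))
      (λ v → Q-injective (trans[ Q H ] (hu≈kQ (to (q X) v)) (sym[ Q H ] (q-factor h k uV hu≈kV v))))

module _ (g : EqHypHom B C) (f : EqHypHom A B) where

  saturated-∘ : SaturatedEmbedding g → SaturatedEmbedding f → SaturatedEmbedding (g ∘ f)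
  saturated-∘ g-sat f-sat = record
    { E-injective = λ r → F.E-injective (G.E-injective r)
    ; V-injective = λ r → F.V-injective (G.V-injective r)
    ; Q-injective = λ r → F.Q-injective (G.Q-injective r)
    ; saturated   = saturated
    }
    where
    module G = SaturatedEmbedding g-sat
    module F = SaturatedEmbedding f-sat

    saturated : ∀ v y → [ Q C ] to (q C) v ≈ to (hQ (g ∘ f)) y →
      Σ (Carrier (V A)) λ w → [ V C ] to (hV (g ∘ f)) w ≈ v
    saturated v y qv≈gfy with G.saturated v (to (hQ f) y) qv≈gfy
    ... | w , gw≈v with F.saturated w y (G.Q-injective
          (trans[ Q C ] (q-comm g w) (trans[ Q C ] (cong (q C) gw≈v) qv≈gfy)))
    ... | w' , fw'≈w = w' , trans[ V C ] (cong (hV g) fw'≈w) gw≈v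

  saturated-cancelˡ : SaturatedEmbedding g → SaturatedEmbedding (g ∘ f) → SaturatedEmbedding f
  saturated-cancelˡ g-sat gf-sat = record
    { E-injective = λ r → GF.E-injective (cong (hE g) r)
    ; V-injective = λ r → GF.V-injective (cong (hV g) r)
    ; Q-injective = λ r → GF.Q-injective (cong (hQ g) r)
    ; saturated   = saturated
    }
    where
    module G = SaturatedEmbedding g-sat
    module GF = SaturatedEmbedding gf-sat

    saturated : ∀ v y → [ Q B ] to (q B) v ≈ to (hQ f) y → Σ (Carrier (V A)) λ w → [ V B ] to (hV f) w ≈ v
    saturated v y qv≈fy with GF.saturated (to (hV g) v) y
                               (trans[ Q C ] (sym[ Q C ] (q-comm g v)) (cong (hQ g) qv≈fy))
    ... | w , gfw≈gv = w , G.V-injective gfw≈gv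

iso⇒saturated : (f : EqHypHom A B) → IsIso f → SaturatedEmbedding f
iso⇒saturated {A} f (f⁻¹ , (E-inv , V-inv , Q-inv) , (_ , V-inv' , _)) = record
  { E-injective = λ {x} {x'} r → trans[ E A ] (sym[ E A ] (E-inv x)) (trans[ E A ] (cong (hE f⁻¹) r) (E-inv x'))
  ; V-injective = λ {x} {x'} r → trans[ V A ] (sym[ V A ] (V-inv x)) (trans[ V A ] (cong (hV f⁻¹) r) (V-inv x'))
  ; Q-injective = λ {x} {x'} r → trans[ Q A ] (sym[ Q A ] (Q-inv x)) (trans[ Q A ] (cong (hQ f⁻¹) r) (Q-inv x'))
  ; saturated   = λ v _ _ → to (hV f⁻¹) v , V-inv' v
  }

saturated-pullback : (f : EqHypHom B D) (g : EqHypHom C D) (p₁ : EqHypHom P B) (p₂ : EqHypHom P C) →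
  IsPullback f g p₁ p₂ → SaturatedEmbedding g → SaturatedEmbedding p₁
saturated-pullback {B} {D} {C} {P} f g p₁ p₂ pb@((cE , cV , cQ) , _) g-sat = record
  { E-injective = injective-pullback (hE f) (hE g) (hE p₁) (hE p₂) cE PE.jointly-injective G.E-injective
  ; V-injective = injective-pullback (hV f) (hV g) (hV p₁) (hV p₂) cV PV.jointly-injective G.V-injective
  ; Q-injective = injective-pullback (hQ f) (hQ g) (hQ p₁) (hQ p₂) cQ Q-jointly-injective G.Q-injective
  ; saturated   = saturated
  }
  where
  open ComponentwisePullback (pullback⇒componentwise {f = f} {g} {p₁} {p₂} pb)
  module PE = IsSetoidPullback E-pullback
  module PV = IsSetoidPullback V-pullback
  module G = SaturatedEmbedding g-sat

  saturated : ∀ v y → [ Q B ] to (q B) v ≈ to (hQ p₁) y → Σ (Carrier (V P)) λ z → [ V B ] to (hV p₁) z ≈ v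
  saturated v y qv≈p₁y with G.saturated (to (hV f) v) (to (hQ p₂) y)
                              (trans[ Q D ] (sym[ Q D ] (q-comm f v)) (trans[ Q D ] (cong (hQ f) qv≈p₁y) (cQ y)))
  ... | w , gw≈fv with PV.covers v w (sym[ V D ] gw≈fv)
  ... | z , p₁z≈v , _ = z , p₁z≈v

saturated-pushout : (f : EqHypHom A B) (m : EqHypHom A C) (n : EqHypHom B D) (g : EqHypHom C D) →
  IsPushout f m n g → SaturatedEmbedding m → SaturatedEmbedding n
saturated-pushout {A} {B} {C} {D} f m n g po m-sat = record
  { E-injective = λ r → IE.inl-injective (PE.kernel {inj₁ _} {inj₁ _} r)
  ; V-injective = λ r → IV.inl-injective (PV.kernel {inj₁ _} {inj₁ _} r)
  ; Q-injective = λ r → IQ.inl-injective (PQ.kernel {inj₁ _} {inj₁ _} r)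
  ; saturated   = λ v y qv≈ny → saturated v y qv≈ny (proj₁ (PV.covers v)) (proj₂ (PV.covers v))
  }
  where
  open ComponentwisePushout (pushout⇒componentwise {f = f} {m} {n} {g} po)
  module PE = IsSetoidPushout E-pushout
  module PV = IsSetoidPushout V-pushout
  module PQ = IsSetoidPushout Q-pushout
  module M = SaturatedEmbedding m-sat
  module IE = SetoidPushout.AlongInjection (hE f) (hE m) M.E-injective
  module IV = SetoidPushout.AlongInjection (hV f) (hV m) M.V-injective
  module IQ = SetoidPushout.AlongInjection (hQ f) (hQ m) M.Q-injective

  saturated : ∀ v y → [ Q D ] to (q D) v ≈ to (hQ n) y → ∀ x → [ V D ] copair (hV n) (hV g) x ≈ v →
    Σ (Carrier (V B)) λ b → [ V D ] to (hV n) b ≈ v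
  saturated v y qv≈ny (inj₁ b) nb≈v = b , nb≈v
  saturated v y qv≈ny (inj₂ c) gc≈v with IQ.inl∼inr⇒image (SetoidPushout.∼-sym
      (PQ.kernel {inj₂ (to (q C) c)} {inj₁ y}
        (trans[ Q D ] (q-comm g c) (trans[ Q D ] (cong (q D) gc≈v) qv≈ny))))
  ... | a , ma≈qc with M.saturated c a (sym[ Q C ] ma≈qc)
  ... | a' , ma'≈c = to (hV f) a' ,
    trans[ V D ] (PV.commutes a') (trans[ V D ] (cong (hV g) ma'≈c) gc≈v)

pullback-swap : (f : EqHypHom B D) (g : EqHypHom C D) (p₁ : EqHypHom P B) (p₂ : EqHypHom P C) →
  IsPullback f g p₁ p₂ → IsPullback g f p₂ p₁
pullback-swap f g p₁ p₂ (commutes , universal) =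
  ≈-sym {h = f ∘ p₁} {g ∘ p₂} commutes , λ x₁ x₂ x-commutes →
    let (u , p₁u≈x₂ , p₂u≈x₁ , unique) = universal x₂ x₁ (≈-sym {h = g ∘ x₁} {f ∘ x₂} x-commutes)
    in u , p₂u≈x₁ , p₁u≈x₂ , λ u' p₂u'≈x₁ p₁u'≈x₂ → unique u' p₁u'≈x₂ p₂u'≈x₁

pushout-swap : (f : EqHypHom A B) (m : EqHypHom A C) (n : EqHypHom B D) (g : EqHypHom C D) →
  IsPushout f m n g → IsPushout m f g n
pushout-swap f m n g (commutes , universal) =
  ≈-sym {h = n ∘ f} {g ∘ m} commutes , λ y₁ y₂ y-glue →
    let (u , un≈y₂ , ug≈y₁ , unique) = universal y₂ y₁ (≈-sym {h = y₁ ∘ m} {y₂ ∘ f} y-glue)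
    in u , ug≈y₁ , un≈y₂ , λ u' u'g≈y₁ u'n≈y₂ → unique u' u'n≈y₂ u'g≈y₁

Pb-admissible : AdmissibleClass Pb
Pb-admissible = record
  { monos            = λ f f-Pb → regularMono⇒mono f (proj₁ f-Pb)
  ; isos             = λ f f-iso → saturated⇒Pb f (iso⇒saturated f f-iso)
  ; composition      = λ g f g-Pb f-Pb →
      saturated⇒Pb (g ∘ f) (saturated-∘ g f (Pb⇒saturated g g-Pb) (Pb⇒saturated f f-Pb))
  ; decomposition    = λ g f g-Pb gf-Pb →
      saturated⇒Pb f (saturated-cancelˡ g f (Pb⇒saturated g g-Pb) (Pb⇒saturated (g ∘ f) gf-Pb))
  ; pullback-stable₁ = λ f g p₁ p₂ pb g-Pb →
      saturated⇒Pb p₁ (saturated-pullback f g p₁ p₂ pb (Pb⇒saturated g g-Pb))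
  ; pullback-stable₂ = λ f g p₁ p₂ pb f-Pb →
      saturated⇒Pb p₂ (saturated-pullback g f p₂ p₁ (pullback-swap f g p₁ p₂ pb) (Pb⇒saturated f f-Pb))
  ; pushout-stable₁  = λ f m n g po m-Pb →
      saturated⇒Pb n (saturated-pushout f m n g po (Pb⇒saturated m m-Pb))
  ; pushout-stable₂  = λ f m n g po f-Pb →
      saturated⇒Pb g (saturated-pushout m f g n (pushout-swap f m n g po) (Pb⇒saturated f f-Pb))
  }

module SetoidCube {A B C D A' B' C' D' : Setoid₀}
  (f : Func A B) (m : Func A C) (n : Func B D) (g : Func C D)
  (f' : Func A' B') (m' : Func A' C') (n' : Func B' D') (g' : Func C' D')
  (a : Func A' A) (b : Func B' B) (c : Func C' C) (d : Func D' D)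
  (top : (n' ∘ᶠ f') ≈ᶠ (g' ∘ᶠ m')) (back : (f ∘ᶠ a) ≈ᶠ (b ∘ᶠ f')) (left : (m ∘ᶠ a) ≈ᶠ (c ∘ᶠ m'))
  (front : (g ∘ᶠ c) ≈ᶠ (d ∘ᶠ g')) (right : (n ∘ᶠ b) ≈ᶠ (d ∘ᶠ n'))
  (bottom : IsSetoidPushout f m n g) (m-injective : Injectiveᶠ m)
  (back-covers : Covers f b a f') (left-covers : Covers m c a m')
  where

  module Bottom = SetoidPushout f m
  module Top = SetoidPushout f' m'
  open Bottom using (_∼_; _≋_)
  open Bottom.AlongInjection m-injective
  open IsSetoidPushout bottom using (kernel)

  TopCovers : Set
  TopCovers = ∀ y → Σ (Carrier B' ⊎ Carrier C') λ w → [ D' ] copair n' g' w ≈ y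

  vertical : Carrier B' ⊎ Carrier C' → Carrier B ⊎ Carrier C
  vertical (inj₁ y) = inj₁ (to b y)
  vertical (inj₂ z) = inj₂ (to c z)

  vertical-copair : ∀ w → [ D ] copair n g (vertical w) ≈ to d (copair n' g' w)
  vertical-copair (inj₁ y) = right y
  vertical-copair (inj₂ z) = front z

  Over-lift : ∀ {a₀} w → Bottom.Over a₀ (vertical w) → Σ (Carrier A') λ x → [ A ] to a x ≈ a₀ × Top.Over x w
  Over-lift (inj₁ y) fa₀≈by = back-covers _ y fa₀≈by
  Over-lift (inj₂ z) ma₀≈cz = left-covers _ z ma₀≈cz

  over : Carrier A' → Carrier B ⊎ Carrier C → Carrier B' ⊎ Carrier C'
  over x (inj₁ _) = inj₁ (to f' x)
  over x (inj₂ _) = inj₂ (to m' x)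

  over-≋ : ∀ {a₀ x} y → Bottom.Over a₀ y → [ A ] to a x ≈ a₀ → vertical (over x y) ≋ y
  over-≋ {x = x} (inj₁ _) fa₀≈y ax≈a₀ =
    inj₁ (trans[ B ] (sym[ B ] (back x)) (trans[ B ] (cong f ax≈a₀) fa₀≈y))
  over-≋ {x = x} (inj₂ _) ma₀≈y ax≈a₀ =
    inj₂ (trans[ C ] (sym[ C ] (left x)) (trans[ C ] (cong m ax≈a₀) ma₀≈y))

  over-∼ : ∀ x y → inj₁ (to f' x) Top.∼ over x y
  over-∼ x (inj₁ _) = Top.∼-refl
  over-∼ x (inj₂ _) = Top.glue x

  -- by the normal form ≃ only one gluing step has to be lifted, through the back and left faces
  ∼-lift : ∀ w y → vertical w ∼ y → Σ (Carrier B' ⊎ Carrier C') λ w' → vertical w' ≋ y × w' Top.∼ w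
  ∼-lift w y r with ∼⇒≃ r
  ... | same p = w , p , Top.∼-refl
  ... | glued a₁ a₂ o₁ o₂ fa₁≈fa₂ with Over-lift w o₁
  ... | x₁ , ax₁≈a₁ , o₁' with back-covers a₂ (to f' x₁)
        (trans[ B ] (sym[ B ] fa₁≈fa₂) (trans[ B ] (cong f (sym[ A ] ax₁≈a₁)) (back x₁)))
  ... | x₂ , ax₂≈a₂ , f'x₂≈f'x₁ =
    over x₂ y , over-≋ y o₂ ax₂≈a₂ ,
    Top.∼-trans (Top.∼-sym (over-∼ x₂ y)) (Top.∼-trans (Top.inl-cong f'x₂≈f'x₁) (Top.Over⇒∼ w o₁'))

  covers-summand : TopCovers → ∀ x y → [ D ] copair n g x ≈ to d y →
    Σ (Carrier B' ⊎ Carrier C') λ w → vertical w ≋ x × [ D' ] copair n' g' w ≈ y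
  covers-summand top-covers x y r with top-covers y
  ... | w , w↦y with ∼-lift w x (kernel {vertical w} {x}
                      (trans[ D ] (vertical-copair w) (trans[ D ] (cong d w↦y) (sym[ D ] r))))
  ... | w' , w'≋x , w'∼w = w' , w'≋x , trans[ D' ] (Top.copair-cong n' g' top w'∼w) w↦y

  front-covers : TopCovers → Covers g d c g'
  front-covers top-covers x y r with covers-summand top-covers (inj₂ x) y r
  ... | inj₂ z , inj₂ cz≈x , g'z≈y = z , cz≈x , g'z≈y

  right-covers : TopCovers → Covers n d b n'
  right-covers top-covers x y r with covers-summand top-covers (inj₁ x) y r
  ... | inj₁ z , inj₁ bz≈x , n'z≈y = z , bz≈x , n'z≈y

  top-covers : Covers g d c g' → Covers n d b n' → TopCovers
  top-covers front-cov right-cov y with IsSetoidPushout.covers bottom (to d y)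
  ... | inj₁ x , nx≈dy = let (z , _ , n'z≈y) = right-cov x y nx≈dy in inj₁ z , n'z≈y
  ... | inj₂ x , gx≈dy = let (z , _ , g'z≈y) = front-cov x y gx≈dy in inj₂ z , g'z≈y

  top-kernel : Injectiveᶠ b → Injectiveᶠ c →
    ∀ {w w'} → [ D' ] copair n' g' w ≈ copair n' g' w' → w Top.∼ w'
  top-kernel b-injective c-injective {w} {w'} r
    with ∼-lift w (vertical w') (kernel {vertical w} {vertical w'}
           (trans[ D ] (vertical-copair w) (trans[ D ] (cong d r) (sym[ D ] (vertical-copair w')))))
  ... | w'' , w''≋w' , w''∼w = Top.∼-trans (Top.∼-sym w''∼w) (vertical-reflects w'' w' w''≋w')
    where
    vertical-reflects : ∀ w w' → vertical w ≋ vertical w' → w Top.∼ w'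
    vertical-reflects (inj₁ _) (inj₁ _) (inj₁ p) = Top.inl-cong (b-injective p)
    vertical-reflects (inj₂ _) (inj₂ _) (inj₂ p) = Top.inr-cong (c-injective p)

Q-covers : (f : EqHypHom B D) (g : EqHypHom C D) (p₁ : EqHypHom P B) (p₂ : EqHypHom P C) →
  Covers (hV f) (hV g) (hV p₁) (hV p₂) → SaturatedEmbedding g → Covers (hQ f) (hQ g) (hQ p₁) (hQ p₂)
Q-covers {B} {D} {C} {P} f g p₁ p₂ V-covers g-sat x y fx≈gy with q-surjective B x
... | v , qv≈x = cover (G.saturated (to (hV f) v) y qfv≈gy)
  where
  module G = SaturatedEmbedding g-sat

  qfv≈gy : [ Q D ] to (q D) (to (hV f) v) ≈ to (hQ g) y
  qfv≈gy = trans[ Q D ] (sym[ Q D ] (q-comm f v)) (trans[ Q D ] (cong (hQ f) qv≈x) fx≈gy)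

  cover : Σ (Carrier (V C)) (λ w → [ V D ] to (hV g) w ≈ to (hV f) v) →
    Σ (Carrier (Q P)) λ z → [ Q B ] to (hQ p₁) z ≈ x × [ Q C ] to (hQ p₂) z ≈ y
  cover (w , gw≈fv) with V-covers v w (sym[ V D ] gw≈fv)
  ... | z , p₁z≈v , p₂z≈w =
    to (q P) z ,
    trans[ Q B ] (q-comm p₁ z) (trans[ Q B ] (cong (q B) p₁z≈v) qv≈x) ,
    trans[ Q C ] (q-comm p₂ z) (trans[ Q C ] (cong (q C) p₂z≈w) qw≈y)
    where
    qw≈y : [ Q C ] to (q C) w ≈ y
    qw≈y = G.Q-injective (trans[ Q D ] (q-comm g w) (trans[ Q D ] (cong (q D) gw≈fv) qfv≈gy))

classes-covered : (n : EqHypHom B D) (g : EqHypHom C D) →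
  (∀ v → Σ (Carrier (V B) ⊎ Carrier (V C)) λ x → [ V D ] copair (hV n) (hV g) x ≈ v) →
  ∀ y → Σ (Carrier (Q B) ⊎ Carrier (Q C)) λ x → [ Q D ] copair (hQ n) (hQ g) x ≈ y
classes-covered {B} {D} {C} n g V-covers y with q-surjective D y
... | v , qv≈y with V-covers v
... | inj₁ x , nx≈v = inj₁ (to (q B) x) , trans[ Q D ] (q-comm n x) (trans[ Q D ] (cong (q D) nx≈v) qv≈y)
... | inj₂ x , gx≈v = inj₂ (to (q C) x) , trans[ Q D ] (q-comm g x) (trans[ Q D ] (cong (q D) gx≈v) qv≈y)

module VanKampen {A B C D A' B' C' D' : EqHyp}
  (f : EqHypHom A B) (m : EqHypHom A C) (n : EqHypHom B D) (g : EqHypHom C D)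
  (f' : EqHypHom A' B') (m' : EqHypHom A' C') (n' : EqHypHom B' D') (g' : EqHypHom C' D')
  (a : EqHypHom A' A) (b : EqHypHom B' B) (c : EqHypHom C' C) (d : EqHypHom D' D)
  (top : n' ∘ f' ≈ g' ∘ m') (back : f ∘ a ≈ b ∘ f') (left : m ∘ a ≈ c ∘ m')
  (front : g ∘ c ≈ d ∘ g') (right : n ∘ b ≈ d ∘ n')
  (bottom : IsPushout f m n g) (back-pullback : IsPullback f b a f') (left-pullback : IsPullback m c a m')
  (m-sat : SaturatedEmbedding m) (b-sat : SaturatedEmbedding b) (c-sat : SaturatedEmbedding c)
  where

  open ComponentwisePushout (pushout⇒componentwise {f = f} {m} {n} {g} bottom)
  module Back = ComponentwisePullback (pullback⇒componentwise {f = f} {b} {a} {f'} back-pullback)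
  module Left = ComponentwisePullback (pullback⇒componentwise {f = m} {c} {a} {m'} left-pullback)
  module M = SaturatedEmbedding m-sat
  module Bs = SaturatedEmbedding b-sat
  module Cs = SaturatedEmbedding c-sat

  module CubeE = SetoidCube (hE f) (hE m) (hE n) (hE g) (hE f') (hE m') (hE n') (hE g') (hE a) (hE b) (hE c) (hE d)
    (proj₁ top) (proj₁ back) (proj₁ left) (proj₁ front) (proj₁ right) E-pushout M.E-injective
    (IsSetoidPullback.covers Back.E-pullback) (IsSetoidPullback.covers Left.E-pullback)
  module CubeV = SetoidCube (hV f) (hV m) (hV n) (hV g) (hV f') (hV m') (hV n') (hV g') (hV a) (hV b) (hV c) (hV d)
    (proj₁ (proj₂ top)) (proj₁ (proj₂ back)) (proj₁ (proj₂ left)) (proj₁ (proj₂ front)) (proj₁ (proj₂ right))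
    V-pushout M.V-injective
    (IsSetoidPullback.covers Back.V-pullback) (IsSetoidPullback.covers Left.V-pullback)
  module CubeQ = SetoidCube (hQ f) (hQ m) (hQ n) (hQ g) (hQ f') (hQ m') (hQ n') (hQ g') (hQ a) (hQ b) (hQ c) (hQ d)
    (proj₂ (proj₂ top)) (proj₂ (proj₂ back)) (proj₂ (proj₂ left)) (proj₂ (proj₂ front)) (proj₂ (proj₂ right))
    Q-pushout M.Q-injective
    (Q-covers f b a f' (IsSetoidPullback.covers Back.V-pullback) b-sat)
    (Q-covers m c a m' (IsSetoidPullback.covers Left.V-pullback) c-sat)

  pushout⇒pullbacks : IsPushout f' m' n' g' → IsPullback g d c g' × IsPullback n d b n'
  pushout⇒pullbacks top-pushout =
    componentwise⇒pullback {f = g} {d} {c} {g'} (record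
      { E-pullback          = record { commutes = proj₁ front ; covers = CubeE.front-covers E.covers
                                     ; jointly-injective = λ r _ → Cs.E-injective r }
      ; V-pullback          = record { commutes = proj₁ (proj₂ front) ; covers = CubeV.front-covers V.covers
                                     ; jointly-injective = λ r _ → Cs.V-injective r }
      ; Q-jointly-injective = λ r _ → Cs.Q-injective r
      }) ,
    componentwise⇒pullback {f = n} {d} {b} {n'} (record
      { E-pullback          = record { commutes = proj₁ right ; covers = CubeE.right-covers E.covers
                                     ; jointly-injective = λ r _ → Bs.E-injective r }
      ; V-pullback          = record { commutes = proj₁ (proj₂ right) ; covers = CubeV.right-covers V.covers
                                     ; jointly-injective = λ r _ → Bs.V-injective r }
      ; Q-jointly-injective = λ r _ → Bs.Q-injective r
      })
    where
    open ComponentwisePushout (pushout⇒componentwise {f = f'} {m'} {n'} {g'} top-pushout)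
      renaming (E-pushout to top-E; V-pushout to top-V)
    module E = IsSetoidPushout top-E
    module V = IsSetoidPushout top-V

  pullbacks⇒pushout : IsPullback g d c g' × IsPullback n d b n' → IsPushout f' m' n' g'
  pullbacks⇒pushout (front-pullback , right-pullback) = componentwise⇒pushout {f = f'} {m'} {n'} {g'} (record
    { E-pushout = record
      { commutes = proj₁ top
      ; covers   = CubeE.top-covers (IsSetoidPullback.covers Front.E-pullback) (IsSetoidPullback.covers Right.E-pullback)
      ; kernel   = CubeE.top-kernel Bs.E-injective Cs.E-injective
      }
    ; V-pushout = record
      { commutes = proj₁ (proj₂ top)
      ; covers   = V-covers
      ; kernel   = CubeV.top-kernel Bs.V-injective Cs.V-injective
      }
    ; Q-pushout = record
      { commutes = proj₂ (proj₂ top)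
      ; covers   = classes-covered n' g' V-covers
      ; kernel   = CubeQ.top-kernel Bs.Q-injective Cs.Q-injective
      }
    })
    where
    module Front = ComponentwisePullback (pullback⇒componentwise {f = g} {d} {c} {g'} front-pullback)
    module Right = ComponentwisePullback (pullback⇒componentwise {f = n} {d} {b} {n'} right-pullback)
    V-covers : CubeV.TopCovers
    V-covers = CubeV.top-covers (IsSetoidPullback.covers Front.V-pullback) (IsSetoidPullback.covers Right.V-pullback)

corollary4p15 : IsMAdhesive Pb
corollary4p15 = record
  { admissible        = Pb-admissible
  ; pullbacks-along-M = λ f g _ → let open EqHypPullback f g in Pullback , π₁ , π₂ , pullback
  ; pushouts-along-M  = λ f m _ → let open EqHypPushout f m in Pushout , ι₁ , ι₂ , pushout
  ; van-kampen        = λ f m n g m-Pb bottom → bottom ,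
      -- the vertical arrows a and d need not lie in Pb
      λ f' m' n' g' a b c d top back left front right back-pullback left-pullback _ b-Pb c-Pb _ →
        let open VanKampen f m n g f' m' n' g' a b c d top back left front right bottom back-pullback
                           left-pullback (Pb⇒saturated m m-Pb) (Pb⇒saturated b b-Pb) (Pb⇒saturated c c-Pb)
        in pushout⇒pullbacks , pullbacks⇒pushout
  }
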